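{- Let $1\le k\le n$, excluding the case where $n$ is odd and $k=1$. Then there are numbers $\gamma^D_{n,k,p}$ such that $$\mathfrak{WD}_{n,k}(x):=\sum_{\pi\in D_n}x^{\mathrm{des}_k^D(\pi)}=\sum_{p=0}^{\lfloor (n-k+1)/2\rfloor}\gamma^D_{n,k,p}\,x^p(1+x)^{n-k+1-2p},$$ and for all $2\le k\le n$ one has $\gamma^D_{n,k,p}=\gamma^B_{n,k,p}/2$, where $\gamma^B_{n,k,p}=2^{2p+k-1}|\Gamma^{(\ell)}_{n,k,p}|$.
   Context: $B_n$ is the set of signed permutations of $[n]$: bijections $\pi$ of $\{\pm1,\dots,\pm n\}$ with $\pi(-i)=-\pi(i)$, written $\pi=(\pi(1),\dots,\pi(n))$; set $\pi(0)=0$. $D_n=\{\pi\in B_n:\ |\{i\in[n]:\pi(i)<0\}|\text{ is even}\}$, and $\mathrm{des}_k^D(\pi)=|\{0\le i\le n-k:\pi(i)>\pi(i+k)\}|$. $\mathfrak{S}_n$ is the symmetric group on $[n]$; for $\sigma\in\mathfrak{S}_n$ with convention $\sigma(0)=0$, $\mathrm{lpeak}_k(\sigma)=|\{k\le i\le n-k:\sigma(i-k)<\sigma(i)>\sigma(i+k)\}|$, and $\Gamma^{(\ell)}_{n,k,p}=\{\sigma\in\mathfrak{S}_n:\mathrm{lpeak}_k(\sigma)=p\}$. -}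

module Defs where

open import Data.Nat as ℕ using (ℕ; zero; suc; _≤_; _<_; _≤?_; _<?_; _∸_)
open import Data.Integer as ℤ using (ℤ; +_; -_; ∣_∣)
open import Data.List using (List; []; _∷_; map; concatMap; filter; length; upTo; lookup; foldr)
open import Data.List.Relation.Unary.All using (All; all?)
import Data.List.Relation.Unary.Unique.DecPropositional as UniqueℕMod
open import Data.Product using (_×_)
open import Relation.Nullary using (¬_; Dec; yes; no; ¬?)
open import Relation.Nullary.Decidable using (_×-dec_)
open import Relation.Binary.PropositionalEquality using (_≡_)

open UniqueℕMod ℕ._≟_ using (Unique; unique?)

words : {A : Set} → List A → ℕ → List (List A)
words xs zero    = [] ∷ []
words xs (suc n) = concatMap (λ x → map (x ∷_) (words xs n)) xs

symRange : ℕ → List ℤ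
symRange n = map (λ i → - (+ suc i)) (upTo n) Data.List.++ (+ 0 ∷ map (λ i → + suc i) (upTo n))

-- value at position i with convention w(0) = 0 (w = (w(1),...,w(n)))
at : {A : Set} → A → List A → ℕ → A
at z w zero = z
at z [] (suc i) = z
at z (x ∷ w) (suc zero) = x
at z (x ∷ w) (suc (suc i)) = at z w (suc i)

negCount : List ℤ → ℕ
negCount w = length (filter (λ x → x ℤ.<? + 0) w)

-- w = (π(1),...,π(n)) is a signed permutation of [n]:
-- entries nonzero, of absolute value ≤ n (automatic from symRange), absolute values distinct.
IsSignedPerm : List ℤ → Set
IsSignedPerm w = All (λ x → ¬ (x ≡ + 0)) w × Unique (map ∣_∣ w)

isSignedPerm? : (w : List ℤ) → Dec (IsSignedPerm w)
isSignedPerm? w = all? (λ x → ¬? (x ℤ.≟ + 0)) w ×-dec unique? (map ∣_∣ w)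

Bn : ℕ → List (List ℤ)
Bn n = filter isSignedPerm? (words (symRange n) n)

Dn : ℕ → List (List ℤ)
Dn n = filter (λ w → negCount w ℕ.% 2 ℕ.≟ 0) (Bn n)

Sn : ℕ → List (List ℕ)
Sn n = filter unique? (words (map suc (upTo n)) n)

desD : ℕ → ℕ → List ℤ → ℕ
desD n k w = length (filter (λ i → (i ℕ.+ k ≤? n) ×-dec (at (+ 0) w (i ℕ.+ k) ℤ.<? at (+ 0) w i)) (upTo (suc n)))

lpeak : ℕ → ℕ → List ℕ → ℕ
lpeak n k s = length (filter (λ i → (k ≤? i) ×-dec ((i ℕ.+ k ≤? n) ×-dec
                 ((at 0 s (i ∸ k) <? at 0 s i) ×-dec (at 0 s (i ℕ.+ k) <? at 0 s i)))) (upTo (suc n)))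

GammaCard : ℕ → ℕ → ℕ → ℕ
GammaCard n k p = length (filter (λ s → lpeak n k s ℕ.≟ p) (Sn n))

sumℤ : List ℤ → ℤ
sumℤ = foldr ℤ._+_ (+ 0)

WD : ℕ → ℕ → ℤ → ℤ
WD n k x = sumℤ (map (λ w → x ℤ.^ desD n k w) (Dn n))

gammaExpansion : ℕ → ℕ → (ℕ → ℤ) → ℤ → ℤ
gammaExpansion n k γ x =
  sumℤ (map (λ p → γ p ℤ.* (x ℤ.^ p) ℤ.* ((+ 1 ℤ.+ x) ℤ.^ (m ∸ 2 ℕ.* p))) (upTo (suc (m ℕ./ 2))))
  where m = suc n ∸ k

module Submission where

-- A signed permutation is a permutation σ together with a sign vector.  Averaging the parity
-- condition over ω = ±1 gives 2 Σ_{even signs} x^des = T₁(σ) + T₋₁(σ), where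
-- T_ω(σ) = Σ_signs ω^#neg x^des_k.  Summing the signs out from the right, along each residue
-- class mod k, a negative sign always weighs ωx or ω against a positive one, according as the
-- entry exceeds its partner k places to the left or not; hence T_ω(σ) factors as
-- (1 + ω)^a x^p (1 + ωx)^b (x + ω)^c with p = lpeak_k(σ), a = 2p + k - 1 and a + b + c = n.
-- At ω = 1 this is 2^(2p+k-1) x^p (1 + x)^(n+1-k-2p); at ω = -1 it vanishes for k ≥ 2, while for
-- k = 1 it is 0 or ±(1 - x)^n, which for even n expands in the basis x^q (1 + x)^(n-2q) with
-- even coefficients except the constant one, so halving still yields integer γ's.

open import Defs

module SignedDescents where

  open import Data.Bool using (Bool; true; false; if_then_else_; _∧_; not)
  open import Data.Empty using (⊥-elim)
  open import Data.Integer as ℤ using (ℤ; +_; -_; 0ℤ; 1ℤ; _+_; _*_; _^_; _-_; ∣_∣)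
  import Data.Integer.Properties as ℤP
  open import Data.Integer.Tactic.RingSolver using (solve-∀)
  open import Data.List using (List; []; _∷_; [_]; _++_; map; concatMap; filter; length; upTo; reverse; take; drop; replicate; zipWith)
  import Data.List.Properties as List
  open import Data.List.Relation.Unary.All as All using (All; []; _∷_; all?)
  import Data.List.Relation.Unary.All.Properties as All
  open import Data.List.Relation.Unary.AllPairs using (AllPairs; []; _∷_)
  import Data.List.Relation.Unary.AllPairs.Properties as AllPairs
  open import Data.Maybe using (Maybe; just; nothing)
  open import Data.Nat as ℕ using (ℕ; zero; suc; z≤n; s≤s; _∸_; _⊓_; _/_; _%_)
  import Data.Nat.DivMod as ℕ
  import Data.Nat.Properties as ℕP
  import Data.Nat.Tactic.RingSolver as ℕ-Solver
  open import Data.List.Relation.Unary.Unique.DecPropositional ℕ._≟_ using (unique?)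
  open import Data.Unit using (⊤)
  open import Data.Product using (_×_; _,_; proj₁; proj₂; ∃-syntax)
  open import Relation.Binary using (Tri; tri<; tri≈; tri>)
  open import Relation.Binary.PropositionalEquality hiding ([_])
  open import Relation.Nullary using (Dec; yes; no; does; ¬_; ¬?)
  open import Relation.Nullary.Decidable using (dec-true; dec-false; _×-dec_)
  open import Level using (Level)
  open import Relation.Unary using (Pred; Decidable)

  private variable
    A B : Set

  ∑ : List A → (A → ℤ) → ℤ
  ∑ xs f = sumℤ (map f xs)

  guard : Bool → ℤ → ℤ
  guard b z = if b then z else 0ℤ

  ∑-++ : (xs ys : List A) (f : A → ℤ) → ∑ (xs ++ ys) f ≡ ∑ xs f + ∑ ys f
  ∑-++ [] ys f = sym (ℤP.+-identityˡ _)
  ∑-++ (x ∷ xs) ys f rewrite ∑-++ xs ys f = sym (ℤP.+-assoc (f x) _ _)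

  ∑-map : (h : A → B) (xs : List A) (f : B → ℤ) → ∑ (map h xs) f ≡ ∑ xs (λ a → f (h a))
  ∑-map h [] f = refl
  ∑-map h (x ∷ xs) f = cong (_+_ (f (h x))) (∑-map h xs f)

  ∑-concatMap : (g : A → List B) (xs : List A) (f : B → ℤ) →
    ∑ (concatMap g xs) f ≡ ∑ xs (λ a → ∑ (g a) f)
  ∑-concatMap g [] f = refl
  ∑-concatMap g (x ∷ xs) f =
    trans (∑-++ (g x) (concatMap g xs) f) (cong (_+_ (∑ (g x) f)) (∑-concatMap g xs f))

  ∑-cong : (xs : List A) {f g : A → ℤ} → (∀ a → f a ≡ g a) → ∑ xs f ≡ ∑ xs g
  ∑-cong [] e = refl
  ∑-cong (x ∷ xs) e = cong₂ _+_ (e x) (∑-cong xs e)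

  ∑-cong-All : {xs : List A} {f g : A → ℤ} → All (λ a → f a ≡ g a) xs → ∑ xs f ≡ ∑ xs g
  ∑-cong-All [] = refl
  ∑-cong-All (e ∷ es) = cong₂ _+_ e (∑-cong-All es)

  ∑-zero : (xs : List A) → ∑ xs (λ _ → 0ℤ) ≡ 0ℤ
  ∑-zero [] = refl
  ∑-zero (x ∷ xs) = trans (ℤP.+-identityˡ _) (∑-zero xs)

  ∑-+ : (xs : List A) (f g : A → ℤ) → ∑ xs (λ a → f a + g a) ≡ ∑ xs f + ∑ xs g
  ∑-+ [] f g = refl
  ∑-+ (x ∷ xs) f g rewrite ∑-+ xs f g = interchange (f x) (g x) (∑ xs f) (∑ xs g)
    where
    interchange : ∀ a b c d → a + b + (c + d) ≡ a + c + (b + d)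
    interchange = solve-∀

  ∑-*ˡ : (c : ℤ) (xs : List A) (f : A → ℤ) → c * ∑ xs f ≡ ∑ xs (λ a → c * f a)
  ∑-*ˡ c [] f = ℤP.*-zeroʳ c
  ∑-*ˡ c (x ∷ xs) f rewrite sym (∑-*ˡ c xs f) = ℤP.*-distribˡ-+ c (f x) _

  ∑-swap : (xs : List A) (ys : List B) (f : A → B → ℤ) →
    ∑ xs (λ a → ∑ ys (f a)) ≡ ∑ ys (λ b → ∑ xs (λ a → f a b))
  ∑-swap [] ys f = sym (∑-zero ys)
  ∑-swap (x ∷ xs) ys f rewrite ∑-swap xs ys f = sym (∑-+ ys (f x) _)

  ∑-guard : (b : Bool) (xs : List A) (f : A → ℤ) → ∑ xs (λ a → guard b (f a)) ≡ guard b (∑ xs f)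
  ∑-guard true xs f = refl
  ∑-guard false xs f = ∑-zero xs

  guard-∧ : (b c : Bool) (z : ℤ) → guard (b ∧ c) z ≡ guard b (guard c z)
  guard-∧ true c z = refl
  guard-∧ false c z = refl

  guard-*ʳ : (b : Bool) (a c : ℤ) → guard b a * c ≡ guard b (a * c)
  guard-*ʳ true a c = refl
  guard-*ʳ false a c = refl

  guard-cong : {P : Set} (d : Dec P) {a c : ℤ} → (P → a ≡ c) → guard (does d) a ≡ guard (does d) c
  guard-cong (yes p) a≡c = a≡c p
  guard-cong (no _) _ = refl

  ∑-filter : {ℓ : Level} {P : Pred A ℓ} (P? : Decidable P) (xs : List A) (f : A → ℤ) →
    ∑ (filter P? xs) f ≡ ∑ xs (λ a → guard (does (P? a)) (f a))
  ∑-filter P? [] f = refl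
  ∑-filter P? (x ∷ xs) f with does (P? x)
  ... | true = cong (_+_ (f x)) (∑-filter P? xs f)
  ... | false = trans (∑-filter P? xs f) (sym (ℤP.+-identityˡ _))

  length-filter-∑ : {ℓ : Level} {P : Pred A ℓ} (P? : Decidable P) (xs : List A) →
    + length (filter P? xs) ≡ ∑ xs (λ a → guard (does (P? a)) 1ℤ)
  length-filter-∑ P? [] = refl
  length-filter-∑ P? (x ∷ xs) with does (P? x)
  ... | true = trans (ℤP.pos-+ 1 _) (cong (_+_ 1ℤ) (length-filter-∑ P? xs))
  ... | false = trans (length-filter-∑ P? xs) (sym (ℤP.+-identityˡ _))

  ∑-upTo-suc : (h : ℕ) (g : ℕ → ℤ) → ∑ (upTo (suc h)) g ≡ g 0 + ∑ (upTo h) (λ q → g (suc q))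
  ∑-upTo-suc h g = cong (_+_ (g 0)) (trans (cong (λ l → ∑ l g) (sym (List.map-upTo suc h))) (∑-map suc (upTo h) g))

  ∑-upTo-∷ʳ : (h : ℕ) (g : ℕ → ℤ) → ∑ (upTo (suc h)) g ≡ ∑ (upTo h) g + g h
  ∑-upTo-∷ʳ h g = trans (cong (λ l → ∑ l g) (sym (List.upTo-∷ʳ h)))
                        (trans (∑-++ (upTo h) [ h ] g) (cong (_+_ (∑ (upTo h) g)) (ℤP.+-identityʳ (g h))))

  ∑-upTo-δ : (n q : ℕ) (f : ℕ → ℤ) → q ℕ.< n → ∑ (upTo n) (λ p → guard (does (q ℕ.≟ p)) (f p)) ≡ f q
  ∑-upTo-δ (suc n) q f q<1+n with ℕP.<-cmp q n
  ... | tri< q<n _ _ = begin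
    ∑ (upTo (suc n)) δf   ≡⟨ ∑-upTo-∷ʳ n δf ⟩
    ∑ (upTo n) δf + δf n  ≡⟨ cong₂ _+_ (∑-upTo-δ n q f q<n) (cong (λ b → guard b (f n)) (dec-false (q ℕ.≟ n) (ℕP.<⇒≢ q<n))) ⟩
    f q + 0ℤ              ≡⟨ ℤP.+-identityʳ (f q) ⟩
    f q                   ∎
    where
    open ≡-Reasoning
    δf = λ p → guard (does (q ℕ.≟ p)) (f p)
  ... | tri≈ _ refl _ = begin
    ∑ (upTo (suc q)) δf   ≡⟨ ∑-upTo-∷ʳ q δf ⟩
    ∑ (upTo q) δf + δf q  ≡⟨ cong₂ _+_ below (cong (λ b → guard b (f q)) (dec-true (q ℕ.≟ q) refl)) ⟩
    0ℤ + f q              ≡⟨ ℤP.+-identityˡ (f q) ⟩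
    f q                   ∎
    where
    open ≡-Reasoning
    δf = λ p → guard (does (q ℕ.≟ p)) (f p)
    below : ∑ (upTo q) δf ≡ 0ℤ
    below = trans (∑-cong-All (All.map (λ {p} p<q → cong (λ b → guard b (f p)) (dec-false (q ℕ.≟ p) (ℕP.>⇒≢ p<q))) (All.all-upTo q)))
                  (∑-zero (upTo q))
  ... | tri> _ _ q>n = ⊥-elim (ℕP.<⇒≱ q>n (ℕP.≤-pred q<1+n))

  ∑-words-suc : (xs : List A) (n : ℕ) (f : List A → ℤ) →
    ∑ (words xs (suc n)) f ≡ ∑ xs (λ x → ∑ (words xs n) (λ w → f (x ∷ w)))
  ∑-words-suc xs n f = trans (∑-concatMap _ xs f) (∑-cong xs (λ x → ∑-map (x ∷_) (words xs n) f))

  ∑-words-∷ʳ : (xs : List A) (n : ℕ) (f : List A → ℤ) →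
    ∑ (words xs (suc n)) f ≡ ∑ (words xs n) (λ w → ∑ xs (λ x → f (w ++ [ x ])))
  ∑-words-∷ʳ xs zero f =
    trans (∑-words-suc xs zero f) (trans (∑-cong xs (λ x → ℤP.+-identityʳ (f [ x ]))) (sym (ℤP.+-identityʳ _)))
  ∑-words-∷ʳ xs (suc n) f = begin
    ∑ (words xs (suc (suc n))) f                                   ≡⟨ ∑-words-suc xs (suc n) f ⟩
    ∑ xs (λ x → ∑ (words xs (suc n)) (λ w → f (x ∷ w)))            ≡⟨ ∑-cong xs (λ x → ∑-words-∷ʳ xs n (λ w → f (x ∷ w))) ⟩
    ∑ xs (λ x → ∑ (words xs n) (λ w → ∑ xs (λ y → f (x ∷ w ++ [ y ])))) ≡⟨ sym (∑-words-suc xs n _) ⟩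
    ∑ (words xs (suc n)) (λ w → ∑ xs (λ y → f (w ++ [ y ])))      ∎
    where open ≡-Reasoning

  ∑-words-reverse : (xs : List A) (n : ℕ) (f : List A → ℤ) →
    ∑ (words xs n) f ≡ ∑ (words xs n) (λ w → f (reverse w))
  ∑-words-reverse xs zero f = refl
  ∑-words-reverse xs (suc n) f = begin
    ∑ (words xs (suc n)) f                                         ≡⟨ ∑-words-∷ʳ xs n f ⟩
    ∑ (words xs n) (λ w → ∑ xs (λ x → f (w ++ [ x ])))             ≡⟨ ∑-words-reverse xs n _ ⟩
    ∑ (words xs n) (λ w → ∑ xs (λ x → f (reverse w ++ [ x ])))     ≡⟨ ∑-cong (words xs n) (λ w → ∑-cong xs (λ x → cong f (sym (List.unfold-reverse x w)))) ⟩
    ∑ (words xs n) (λ w → ∑ xs (λ x → f (reverse (x ∷ w))))        ≡⟨ ∑-swap (words xs n) xs _ ⟩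
    ∑ xs (λ x → ∑ (words xs n) (λ w → f (reverse (x ∷ w))))        ≡⟨ sym (∑-words-suc xs n _) ⟩
    ∑ (words xs (suc n)) (λ w → f (reverse w))                     ∎
    where open ≡-Reasoning

  words-All : {P : A → Set} (xs : List A) → All P xs → (n : ℕ) →
    All (λ w → length w ≡ n × All P w) (words xs n)
  words-All xs pxs zero = (refl , []) ∷ []
  words-All xs pxs (suc n) =
    All.concat⁺ (All.map⁺ (All.map (λ px → All.map⁺ (All.map (λ (e , pw) → cong suc e , px ∷ pw) (words-All xs pxs n))) pxs))

  ∑-words-cong : {P : A → Set} (xs : List A) → All P xs → (n : ℕ) {f g : List A → ℤ} →
    (∀ w → length w ≡ n → All P w → f w ≡ g w) → ∑ (words xs n) f ≡ ∑ (words xs n) g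
  ∑-words-cong xs pxs n e = ∑-cong-All (All.map (λ (lw , pw) → e _ lw pw) (words-All xs pxs n))

  bools : List Bool
  bools = false ∷ true ∷ []

  positives : ℕ → List ℕ
  positives n = map suc (upTo n)

  Positive : ℕ → Set
  Positive j = 0 ℕ.< j

  positives-All : (n : ℕ) → All Positive (positives n)
  positives-All n = All.map⁺ (All.universal (λ _ → s≤s z≤n) (upTo n))

  bools-All : All (λ _ → ⊤) bools
  bools-All = _ ∷ _ ∷ []

  signed : Bool → ℕ → ℤ
  signed false j = + j
  signed true j = - (+ j)

  withSigns : List Bool → List ℕ → List ℤ
  withSigns = zipWith signed

  trues : List Bool → ℕ
  trues [] = 0
  trues (true ∷ s) = suc (trues s)
  trues (false ∷ s) = trues s

  ∑-bools-words-suc : (n : ℕ) (f : List Bool → ℤ) →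
    ∑ (words bools (suc n)) f ≡ ∑ (words bools n) (λ s → f (false ∷ s)) + ∑ (words bools n) (λ s → f (true ∷ s))
  ∑-bools-words-suc n f = trans (∑-words-suc bools n f) (cong (_+_ (∑ (words bools n) (λ s → f (false ∷ s)))) (ℤP.+-identityʳ _))

  nonzero? : (w : List ℤ) → Dec (All (λ x → ¬ (x ≡ + 0)) w)
  nonzero? = all? (λ x → ¬? (x ℤ.≟ + 0))

  ∑-symRange-nonzero : (n : ℕ) (H : ℤ → ℤ) →
    ∑ (symRange n) (λ x → guard (does (¬? (x ℤ.≟ + 0))) (H x)) ≡ ∑ (positives n) (λ j → H (+ j) + H (- (+ j)))
  ∑-symRange-nonzero n H = begin
    ∑ (symRange n) F
      ≡⟨ ∑-++ (map (λ i → - (+ suc i)) (upTo n)) _ F ⟩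
    ∑ (map (λ i → - (+ suc i)) (upTo n)) F + (0ℤ + ∑ (map (λ i → + suc i) (upTo n)) F)
      ≡⟨ cong₂ _+_ (∑-map _ (upTo n) F) (trans (ℤP.+-identityˡ _) (∑-map _ (upTo n) F)) ⟩
    ∑ (upTo n) (λ i → H (- (+ suc i))) + ∑ (upTo n) (λ i → H (+ suc i))
      ≡⟨ ℤP.+-comm (∑ (upTo n) (λ i → H (- (+ suc i)))) _ ⟩
    ∑ (upTo n) (λ i → H (+ suc i)) + ∑ (upTo n) (λ i → H (- (+ suc i)))
      ≡⟨ sym (trans (∑-map suc (upTo n) _) (∑-+ (upTo n) _ _)) ⟩
    ∑ (positives n) (λ j → H (+ j) + H (- (+ j))) ∎
    where
    open ≡-Reasoning
    F : ℤ → ℤ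
    F x = guard (does (¬? (x ℤ.≟ + 0))) (H x)

  ∑-nonzero-words : (n ℓ : ℕ) (G : List ℤ → ℤ) →
    ∑ (words (symRange n) ℓ) (λ w → guard (does (nonzero? w)) (G w)) ≡
    ∑ (words (positives n) ℓ) (λ u → ∑ (words bools ℓ) (λ s → G (withSigns s u)))
  ∑-nonzero-words n zero G = sym (ℤP.+-identityʳ _)
  ∑-nonzero-words n (suc ℓ) G = begin
    ∑ (words (symRange n) (suc ℓ)) (λ w → guard (does (nonzero? w)) (G w))
      ≡⟨ ∑-words-suc (symRange n) ℓ _ ⟩
    ∑ (symRange n) (λ x → ∑ (words (symRange n) ℓ) (λ w → guard (x≠0 x ∧ does (nonzero? w)) (G (x ∷ w))))
      ≡⟨ ∑-cong (symRange n) (λ x → trans (∑-cong (words (symRange n) ℓ) (λ w → guard-∧ (x≠0 x) _ _))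
                                          (∑-guard (x≠0 x) (words (symRange n) ℓ) _)) ⟩
    ∑ (symRange n) (λ x → guard (x≠0 x) (∑ (words (symRange n) ℓ) (λ w → guard (does (nonzero? w)) (G (x ∷ w)))))
      ≡⟨ ∑-cong (symRange n) (λ x → cong (guard (x≠0 x)) (∑-nonzero-words n ℓ (λ w → G (x ∷ w)))) ⟩
    ∑ (symRange n) (λ x → guard (x≠0 x) (H x))
      ≡⟨ ∑-symRange-nonzero n H ⟩
    ∑ (positives n) (λ j → H (+ j) + H (- (+ j)))
      ≡⟨ ∑-cong (positives n) (λ j → sym (trans (∑-cong (words (positives n) ℓ) (λ u → ∑-bools-words-suc ℓ _))
                                                 (∑-+ (words (positives n) ℓ) _ _))) ⟩
    ∑ (positives n) (λ j → ∑ (words (positives n) ℓ) (λ u → ∑ (words bools (suc ℓ)) (λ s → G (withSigns s (j ∷ u)))))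
      ≡⟨ sym (∑-words-suc (positives n) ℓ _) ⟩
    ∑ (words (positives n) (suc ℓ)) (λ u → ∑ (words bools (suc ℓ)) (λ s → G (withSigns s u))) ∎
    where
    open ≡-Reasoning
    x≠0 : ℤ → Bool
    x≠0 x = does (¬? (x ℤ.≟ + 0))
    H : ℤ → ℤ
    H y = ∑ (words (positives n) ℓ) (λ u → ∑ (words bools ℓ) (λ s → G (y ∷ withSigns s u)))

  abs-withSigns : (s : List Bool) (u : List ℕ) → length s ≡ length u → map ∣_∣ (withSigns s u) ≡ u
  abs-withSigns [] [] _ = refl
  abs-withSigns (false ∷ s) (j ∷ u) e = cong (j ∷_) (abs-withSigns s u (ℕP.suc-injective e))
  abs-withSigns (true ∷ s) (j ∷ u) e = cong₂ _∷_ (ℤP.∣-i∣≡∣i∣ (+ j)) (abs-withSigns s u (ℕP.suc-injective e))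

  negCount-withSigns : (s : List Bool) (u : List ℕ) → All Positive u → length s ≡ length u →
    negCount (withSigns s u) ≡ trues s
  negCount-withSigns [] [] _ _ = refl
  negCount-withSigns (false ∷ s) (j ∷ u) (_ ∷ pu) e with + j ℤ.<? + 0
  ... | yes (ℤ.+<+ ())
  ... | no _ = negCount-withSigns s u pu (ℕP.suc-injective e)
  negCount-withSigns (true ∷ s) (suc j ∷ u) (_ ∷ pu) e = cong suc (negCount-withSigns s u pu (ℕP.suc-injective e))

  guard-even-*2 : (c : ℕ) (z : ℤ) → guard (does (c % 2 ℕ.≟ 0)) z * + 2 ≡ z + (- 1ℤ) ^ c * z
  guard-even-*2 zero z = double z
    where
    double : ∀ z → z * + 2 ≡ z + 1ℤ * z
    double = solve-∀
  guard-even-*2 (suc zero) z = cancel z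
    where
    cancel : ∀ z → 0ℤ * + 2 ≡ z + - 1ℤ * 1ℤ * z
    cancel = solve-∀
  guard-even-*2 (suc (suc c)) z = begin
    guard (does (suc (suc c) % 2 ℕ.≟ 0)) z * + 2 ≡⟨ cong (λ t → guard (does (t ℕ.≟ 0)) z * + 2) (trans (cong (_% 2) (ℕP.+-comm 2 c)) (ℕ.[m+n]%n≡m%n c 2)) ⟩
    guard (does (c % 2 ℕ.≟ 0)) z * + 2           ≡⟨ guard-even-*2 c z ⟩
    z + (- 1ℤ) ^ c * z                           ≡⟨ sign² ((- 1ℤ) ^ c) z ⟩
    z + (- 1ℤ) ^ suc (suc c) * z                 ∎
    where
    open ≡-Reasoning
    sign² : ∀ a z → z + a * z ≡ z + - 1ℤ * (- 1ℤ * a) * z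
    sign² = solve-∀

  evenSignSum : ℕ → ℕ → ℤ → List ℕ → ℤ
  evenSignSum n k x u = ∑ (words bools n) (λ s → guard (does (negCount (withSigns s u) % 2 ℕ.≟ 0)) (x ^ desD n k (withSigns s u)))

  signSum : ℕ → ℕ → ℤ → ℤ → List ℕ → ℤ
  signSum n k x ω u = ∑ (words bools n) (λ s → ω ^ trues s * x ^ desD n k (withSigns s u))

  WD-∑-unsigned : (n k : ℕ) (x : ℤ) →
    WD n k x ≡ ∑ (words (positives n) n) (λ u → guard (does (unique? u)) (evenSignSum n k x u))
  WD-∑-unsigned n k x = begin
    WD n k x
      ≡⟨ ∑-filter (λ w → negCount w % 2 ℕ.≟ 0) (Bn n) f ⟩
    ∑ (Bn n) (λ w → guard (even w) (f w))
      ≡⟨ ∑-filter isSignedPerm? (words (symRange n) n) _ ⟩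
    ∑ (words (symRange n) n) (λ w → guard (does (isSignedPerm? w)) (guard (even w) (f w)))
      ≡⟨ ∑-cong (words (symRange n) n) (λ w → guard-∧ (does (nonzero? w)) (does (unique? (map ∣_∣ w))) _) ⟩
    ∑ (words (symRange n) n) (λ w → guard (does (nonzero? w)) (G w))
      ≡⟨ ∑-nonzero-words n n G ⟩
    ∑ (words (positives n) n) (λ u → ∑ (words bools n) (λ s → G (withSigns s u)))
      ≡⟨ ∑-words-cong (positives n) (positives-All n) n (λ u lu _ →
           trans (∑-words-cong bools bools-All n (λ s ls _ →
                    cong (λ v → guard (does (unique? v)) (guard (even (withSigns s u)) (f (withSigns s u)))) (abs-withSigns s u (trans ls (sym lu)))))
                 (∑-guard (does (unique? u)) (words bools n) _)) ⟩
    ∑ (words (positives n) n) (λ u → guard (does (unique? u)) (evenSignSum n k x u)) ∎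
    where
    open ≡-Reasoning
    f : List ℤ → ℤ
    f w = x ^ desD n k w
    even : List ℤ → Bool
    even w = does (negCount w % 2 ℕ.≟ 0)
    G : List ℤ → ℤ
    G w = guard (does (unique? (map ∣_∣ w))) (guard (even w) (f w))

  evenSignSum-*2 : (n k : ℕ) (x : ℤ) (u : List ℕ) → All Positive u → length u ≡ n →
    evenSignSum n k x u * + 2 ≡ signSum n k x 1ℤ u + signSum n k x (- 1ℤ) u
  evenSignSum-*2 n k x u pu lu = begin
    evenSignSum n k x u * + 2
      ≡⟨ trans (ℤP.*-comm (evenSignSum n k x u) _) (∑-*ˡ (+ 2) (words bools n) _) ⟩
    ∑ (words bools n) (λ s → + 2 * guard (does (negCount (w s) % 2 ℕ.≟ 0)) (z s))
      ≡⟨ ∑-words-cong bools bools-All n (λ s ls _ → split s ls) ⟩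
    ∑ (words bools n) (λ s → 1ℤ ^ trues s * z s + (- 1ℤ) ^ trues s * z s)
      ≡⟨ ∑-+ (words bools n) _ _ ⟩
    signSum n k x 1ℤ u + signSum n k x (- 1ℤ) u ∎
    where
    open ≡-Reasoning
    w : List Bool → List ℤ
    w s = withSigns s u
    z : List Bool → ℤ
    z s = x ^ desD n k (w s)
    split : ∀ s → length s ≡ n →
      + 2 * guard (does (negCount (w s) % 2 ℕ.≟ 0)) (z s) ≡ 1ℤ ^ trues s * z s + (- 1ℤ) ^ trues s * z s
    split s ls = begin
      + 2 * guard (does (negCount (w s) % 2 ℕ.≟ 0)) (z s) ≡⟨ ℤP.*-comm (+ 2) _ ⟩
      guard (does (negCount (w s) % 2 ℕ.≟ 0)) (z s) * + 2 ≡⟨ guard-even-*2 (negCount (w s)) (z s) ⟩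
      z s + (- 1ℤ) ^ negCount (w s) * z s
        ≡⟨ cong₂ (λ a c → a + (- 1ℤ) ^ c * z s)
             (sym (trans (cong (_* z s) (ℤP.^-zeroˡ (trues s))) (ℤP.*-identityˡ (z s))))
             (negCount-withSigns s u pu (trans ls (sym lu))) ⟩
      1ℤ ^ trues s * z s + (- 1ℤ) ^ trues s * z s ∎

  bit : Bool → ℕ
  bit true = 1
  bit false = 0

  <ᵇ-true : ∀ {m n} → m ℕ.< n → (m ℕ.<ᵇ n) ≡ true
  <ᵇ-true {m} {n} = dec-true (m ℕ.<? n)

  <ᵇ-false : ∀ {m n} → n ℕ.≤ m → (m ℕ.<ᵇ n) ≡ false
  <ᵇ-false {m} {n} n≤m = dec-false (m ℕ.<? n) (ℕP.≤⇒≯ n≤m)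

  nth : A → ℕ → List A → A
  nth d i [] = d
  nth d zero (a ∷ _) = a
  nth d (suc i) (_ ∷ l) = nth d i l

  nth-All : {P : A → Set} {d : A} (i : ℕ) (l : List A) → All P l → i ℕ.< length l → P (nth d i l)
  nth-All zero (a ∷ l) (p ∷ _) _ = p
  nth-All (suc i) (a ∷ l) (_ ∷ ps) (s≤s i<l) = nth-All i l ps i<l

  length-withSigns : (s : List Bool) (u : List ℕ) → length s ≡ length u → length (withSigns s u) ≡ length u
  length-withSigns [] [] e = refl
  length-withSigns (_ ∷ s) (_ ∷ u) e = cong suc (length-withSigns s u (ℕP.suc-injective e))

  -- Words are stored reversed (last entry first), so the partner k = j + 1 places to the left
  -- of the head sits at index j of the tail; index = length is the convention π(0) = 0, and
  -- beyond that the head has no partner.  An entry has slope asc when its partner is smaller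
  -- in absolute value (the origin counts as smaller).
  data Slope : Set where
    asc desc : Slope

  data Partner : Set where
    origin absent : Partner
    entry : ℕ → Slope → Partner

  partner : ℕ → List (ℕ × Slope) → Partner
  partner zero [] = origin
  partner zero ((v , s) ∷ _) = entry v s
  partner (suc i) [] = absent
  partner (suc i) (_ ∷ L) = partner i L

  valueAt : ℕ → List ℤ → Maybe ℤ
  valueAt zero [] = just 0ℤ
  valueAt zero (y ∷ _) = just y
  valueAt (suc i) [] = nothing
  valueAt (suc i) (_ ∷ l) = valueAt i l

  descentFrom : Maybe ℤ → ℤ → ℕ
  descentFrom (just v) y = bit (does (y ℤ.<? v))
  descentFrom nothing y = 0

  slopeOf : Bool → Slope
  slopeOf c = if c then asc else desc

  slopeAfter : Partner → ℕ → Slope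
  slopeAfter origin b = asc
  slopeAfter absent b = desc
  slopeAfter (entry v s) b = slopeOf (v ℕ.<ᵇ b)

  partner-origin : (i : ℕ) (L : List (ℕ × Slope)) → length L ≡ i → partner i L ≡ origin
  partner-origin zero [] e = refl
  partner-origin (suc i) (_ ∷ L) e = partner-origin i L (ℕP.suc-injective e)

  partner-absent : (i : ℕ) (L : List (ℕ × Slope)) → length L ℕ.< i → partner i L ≡ absent
  partner-absent (suc i) [] e = refl
  partner-absent (suc i) (_ ∷ L) (s≤s e) = partner-absent i L e

  valueAt-origin : (i : ℕ) (l : List ℤ) → length l ≡ i → valueAt i l ≡ just 0ℤ
  valueAt-origin zero [] e = refl
  valueAt-origin (suc i) (_ ∷ l) e = valueAt-origin i l (ℕP.suc-injective e)

  valueAt-absent : (i : ℕ) (l : List ℤ) → length l ℕ.< i → valueAt i l ≡ nothing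
  valueAt-absent (suc i) [] e = refl
  valueAt-absent (suc i) (_ ∷ l) (s≤s e) = valueAt-absent i l e

  valueAt-withSigns : (i : ℕ) (s : List Bool) (r : List ℕ) → length s ≡ length r → i ℕ.< length r →
    valueAt i (withSigns s r) ≡ just (signed (nth false i s) (nth 0 i r))
  valueAt-withSigns zero (e ∷ s) (b ∷ r) _ _ = refl
  valueAt-withSigns (suc i) (e ∷ s) (b ∷ r) ls (s≤s i<r) = valueAt-withSigns i s r (ℕP.suc-injective ls) i<r

  data Base : Set where
    [1+ω] [x] [1+ωx] [x+ω] : Base

  -- The exponents of the four bases in factorOf s c.  The one of [x] is 1 exactly when the
  -- partner is a k-peak: its own partner is smaller (asc) and so is the new entry (c = false).
  stepExponent : Base → Slope → Bool → ℕ
  stepExponent [1+ω] asc c = bit (not c)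
  stepExponent [1+ω] desc c = bit c
  stepExponent [x] asc c = bit (not c)
  stepExponent [x] desc c = 0
  stepExponent [1+ωx] asc c = bit c
  stepExponent [1+ωx] desc c = 0
  stepExponent [x+ω] asc c = 0
  stepExponent [x+ω] desc c = bit (not c)

  partnerExponent : Base → Partner → ℕ → ℕ
  partnerExponent e (entry v s) b = stepExponent e s (v ℕ.<ᵇ b)
  partnerExponent e _ b = 0

  countBy : (Slope → ℕ) → List (ℕ × Slope) → ℕ
  countBy f [] = 0
  countBy f ((_ , s) ∷ L) = f s ℕ.+ countBy f L

  partnerBy : (Slope → ℕ) → Partner → ℕ
  partnerBy f (entry _ s) = f s
  partnerBy f _ = 0

  countBy-take-suc : (f : Slope → ℕ) (i : ℕ) (L : List (ℕ × Slope)) →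
    countBy f (take (suc i) L) ≡ countBy f (take i L) ℕ.+ partnerBy f (partner i L)
  countBy-take-suc f zero [] = refl
  countBy-take-suc f zero ((_ , s) ∷ L) = ℕP.+-comm (f s) 0
  countBy-take-suc f (suc i) [] = refl
  countBy-take-suc f (suc i) ((_ , s) ∷ L) =
    trans (cong (f s ℕ.+_) (countBy-take-suc f i L)) (sym (ℕP.+-assoc (f s) _ _))

  isAsc isDesc : Slope → ℕ
  isAsc asc = 1
  isAsc desc = 0
  isDesc asc = 0
  isDesc desc = 1

  windowExponent : Base → Slope → ℕ
  windowExponent [1+ω] s = isDesc s
  windowExponent [1+ωx] s = isAsc s
  windowExponent _ _ = 0

  windowGrowth : Partner → ℕ
  windowGrowth absent = 1
  windowGrowth _ = 0

  PartnerPosition : ℕ → Partner → ℕ → Set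
  PartnerPosition i origin n = n ≡ i
  PartnerPosition i absent n = n ℕ.< i
  PartnerPosition i (entry _ _) n = i ℕ.< n

  partner-position : (i : ℕ) (L : List (ℕ × Slope)) → PartnerPosition i (partner i L) (length L)
  partner-position zero [] = refl
  partner-position zero (_ ∷ L) = s≤s z≤n
  partner-position (suc i) [] = s≤s z≤n
  partner-position (suc i) (_ ∷ L) with partner i L | partner-position i L
  ... | origin | n≡i = cong suc n≡i
  ... | absent | n<i = s≤s n<i
  ... | entry _ _ | i<n = s≤s i<n

  ⊓-partner : (i n : ℕ) (P : Partner) → PartnerPosition i P n → suc n ⊓ i ≡ n ⊓ i ℕ.+ windowGrowth P
  ⊓-partner i n origin refl = trans (ℕP.m≥n⇒m⊓n≡n (ℕP.n≤1+n n)) (sym (trans (ℕP.+-identityʳ _) (ℕP.⊓-idem n)))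
  ⊓-partner i n absent n<i = trans (ℕP.m≤n⇒m⊓n≡m n<i)
    (trans (ℕP.+-comm 1 n) (cong (ℕ._+ 1) (sym (ℕP.m≤n⇒m⊓n≡m (ℕP.<⇒≤ n<i)))))
  ⊓-partner i n (entry _ _) i<n = trans (ℕP.m≥n⇒m⊓n≡n (ℕP.m≤n⇒m≤1+n (ℕP.<⇒≤ i<n)))
    (sym (trans (ℕP.+-identityʳ _) (ℕP.m≥n⇒m⊓n≡n (ℕP.<⇒≤ i<n))))

  descents-balance : (P : Partner) (b : ℕ) →
    partnerExponent [1+ω] P b ℕ.+ isDesc (slopeAfter P b) ≡ 2 ℕ.* partnerExponent [x] P b ℕ.+ partnerBy isDesc P ℕ.+ windowGrowth P
  descents-balance origin b = refl
  descents-balance absent b = refl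
  descents-balance (entry v s) b with s | v ℕ.<ᵇ b
  ... | asc | true = refl
  ... | asc | false = refl
  ... | desc | true = refl
  ... | desc | false = refl

  degree-balance : (P : Partner) (b : ℕ) →
    partnerExponent [1+ωx] P b ℕ.+ partnerExponent [x+ω] P b ℕ.+ isAsc (slopeAfter P b) ℕ.+ 2 ℕ.* partnerExponent [x] P b ℕ.+ windowGrowth P
    ≡ suc (partnerBy isAsc P)
  degree-balance origin b = refl
  degree-balance absent b = refl
  degree-balance (entry v s) b with s | v ℕ.<ᵇ b
  ... | asc | true = refl
  ... | asc | false = refl
  ... | desc | true = refl
  ... | desc | false = refl

  countBy-zero : (L : List (ℕ × Slope)) → countBy (λ _ → 0) L ≡ 0
  countBy-zero [] = refl
  countBy-zero (_ ∷ L) = countBy-zero L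

  module Transfer (j : ℕ) where

    slopes : List ℕ → List (ℕ × Slope)
    slopes [] = []
    slopes (b ∷ r) = (b , slopeAfter (partner j (slopes r)) b) ∷ slopes r

    length-slopes : (r : List ℕ) → length (slopes r) ≡ length r
    length-slopes [] = refl
    length-slopes (b ∷ r) = cong suc (length-slopes r)

    partner-slopes : (i : ℕ) (r : List ℕ) → i ℕ.< length r →
      partner i (slopes r) ≡ entry (nth 0 i r) (slopeAfter (partner j (slopes (drop (suc i) r))) (nth 0 i r))
    partner-slopes zero (b ∷ r) _ = refl
    partner-slopes (suc i) (b ∷ r) (s≤s i<r) = partner-slopes i r i<r

    desRev : List ℤ → ℕ
    desRev [] = 0
    desRev (y ∷ w) = descentFrom (valueAt j w) y ℕ.+ desRev w

    exponent : Base → List ℕ → ℕ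
    exponent e [] = 0
    exponent e (b ∷ r) = partnerExponent e (partner j (slopes r)) b ℕ.+ exponent e r

    window : List ℕ → List (ℕ × Slope)
    window r = take (suc j) (slopes r)

    exponent-[1+ω] : (r : List ℕ) →
      exponent [1+ω] r ℕ.+ countBy isDesc (window r) ≡ 2 ℕ.* exponent [x] r ℕ.+ length r ⊓ j
    exponent-[1+ω] [] = refl
    exponent-[1+ω] (b ∷ r) = begin
      a ℕ.+ E ℕ.+ (d ℕ.+ D)             ≡⟨ shuffle₁ a E d D ⟩
      (a ℕ.+ d) ℕ.+ (E ℕ.+ D)           ≡⟨ cong (ℕ._+ (E ℕ.+ D)) (descents-balance P b) ⟩
      2 ℕ.* X ℕ.+ pd ℕ.+ g ℕ.+ (E ℕ.+ D) ≡⟨ shuffle₂ X pd g E D ⟩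
      2 ℕ.* X ℕ.+ g ℕ.+ (E ℕ.+ (D ℕ.+ pd)) ≡⟨ cong (2 ℕ.* X ℕ.+ g ℕ.+_) ih ⟩
      2 ℕ.* X ℕ.+ g ℕ.+ (2 ℕ.* p ℕ.+ m) ≡⟨ shuffle₃ X g p m ⟩
      2 ℕ.* (X ℕ.+ p) ℕ.+ (m ℕ.+ g)     ≡⟨ cong (2 ℕ.* (X ℕ.+ p) ℕ.+_) (sym (⊓-partner j (length r) P position)) ⟩
      2 ℕ.* (X ℕ.+ p) ℕ.+ suc (length r) ⊓ j ∎
      where
      open ≡-Reasoning
      P = partner j (slopes r)
      a = partnerExponent [1+ω] P b
      X = partnerExponent [x] P b
      d = isDesc (slopeAfter P b)
      pd = partnerBy isDesc P
      g = windowGrowth P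
      E = exponent [1+ω] r
      D = countBy isDesc (take j (slopes r))
      p = exponent [x] r
      m = length r ⊓ j
      position : PartnerPosition j P (length r)
      position = subst (PartnerPosition j P) (length-slopes r) (partner-position j (slopes r))
      ih : E ℕ.+ (D ℕ.+ pd) ≡ 2 ℕ.* p ℕ.+ m
      ih = trans (cong (E ℕ.+_) (sym (countBy-take-suc isDesc j (slopes r)))) (exponent-[1+ω] r)
      shuffle₁ : ∀ a E d D → a ℕ.+ E ℕ.+ (d ℕ.+ D) ≡ (a ℕ.+ d) ℕ.+ (E ℕ.+ D)
      shuffle₁ = ℕ-Solver.solve-∀
      shuffle₂ : ∀ X pd g E D → 2 ℕ.* X ℕ.+ pd ℕ.+ g ℕ.+ (E ℕ.+ D) ≡ 2 ℕ.* X ℕ.+ g ℕ.+ (E ℕ.+ (D ℕ.+ pd))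
      shuffle₂ = ℕ-Solver.solve-∀
      shuffle₃ : ∀ X g p m → 2 ℕ.* X ℕ.+ g ℕ.+ (2 ℕ.* p ℕ.+ m) ≡ 2 ℕ.* (X ℕ.+ p) ℕ.+ (m ℕ.+ g)
      shuffle₃ = ℕ-Solver.solve-∀

    exponent-degree : (r : List ℕ) →
      exponent [1+ωx] r ℕ.+ exponent [x+ω] r ℕ.+ countBy isAsc (window r) ℕ.+ 2 ℕ.* exponent [x] r ℕ.+ length r ⊓ j ≡ length r
    exponent-degree [] = refl
    exponent-degree (b ∷ r) = begin
      e₁ ℕ.+ F₁ ℕ.+ (e₂ ℕ.+ F₂) ℕ.+ (u ℕ.+ U) ℕ.+ 2 ℕ.* (X ℕ.+ p) ℕ.+ suc (length r) ⊓ j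
        ≡⟨ cong (e₁ ℕ.+ F₁ ℕ.+ (e₂ ℕ.+ F₂) ℕ.+ (u ℕ.+ U) ℕ.+ 2 ℕ.* (X ℕ.+ p) ℕ.+_) (⊓-partner j (length r) P position) ⟩
      e₁ ℕ.+ F₁ ℕ.+ (e₂ ℕ.+ F₂) ℕ.+ (u ℕ.+ U) ℕ.+ 2 ℕ.* (X ℕ.+ p) ℕ.+ (m ℕ.+ g)
        ≡⟨ shuffle₁ e₁ F₁ e₂ F₂ u U X p m g ⟩
      (e₁ ℕ.+ e₂ ℕ.+ u ℕ.+ 2 ℕ.* X ℕ.+ g) ℕ.+ (F₁ ℕ.+ F₂ ℕ.+ U ℕ.+ 2 ℕ.* p ℕ.+ m)
        ≡⟨ cong (ℕ._+ (F₁ ℕ.+ F₂ ℕ.+ U ℕ.+ 2 ℕ.* p ℕ.+ m)) (degree-balance P b) ⟩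
      suc pa ℕ.+ (F₁ ℕ.+ F₂ ℕ.+ U ℕ.+ 2 ℕ.* p ℕ.+ m)
        ≡⟨ cong suc (shuffle₂ pa F₁ F₂ U p m) ⟩
      suc (F₁ ℕ.+ F₂ ℕ.+ (U ℕ.+ pa) ℕ.+ 2 ℕ.* p ℕ.+ m)
        ≡⟨ cong suc ih ⟩
      suc (length r) ∎
      where
      open ≡-Reasoning
      P = partner j (slopes r)
      e₁ = partnerExponent [1+ωx] P b
      e₂ = partnerExponent [x+ω] P b
      X = partnerExponent [x] P b
      u = isAsc (slopeAfter P b)
      pa = partnerBy isAsc P
      g = windowGrowth P
      F₁ = exponent [1+ωx] r
      F₂ = exponent [x+ω] r
      U = countBy isAsc (take j (slopes r))
      p = exponent [x] r
      m = length r ⊓ j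
      position : PartnerPosition j P (length r)
      position = subst (PartnerPosition j P) (length-slopes r) (partner-position j (slopes r))
      ih : F₁ ℕ.+ F₂ ℕ.+ (U ℕ.+ pa) ℕ.+ 2 ℕ.* p ℕ.+ m ≡ length r
      ih = trans (cong (λ t → F₁ ℕ.+ F₂ ℕ.+ t ℕ.+ 2 ℕ.* p ℕ.+ m) (sym (countBy-take-suc isAsc j (slopes r)))) (exponent-degree r)
      shuffle₁ : ∀ e₁ F₁ e₂ F₂ u U X p m g →
        e₁ ℕ.+ F₁ ℕ.+ (e₂ ℕ.+ F₂) ℕ.+ (u ℕ.+ U) ℕ.+ 2 ℕ.* (X ℕ.+ p) ℕ.+ (m ℕ.+ g)
        ≡ (e₁ ℕ.+ e₂ ℕ.+ u ℕ.+ 2 ℕ.* X ℕ.+ g) ℕ.+ (F₁ ℕ.+ F₂ ℕ.+ U ℕ.+ 2 ℕ.* p ℕ.+ m)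
      shuffle₁ = ℕ-Solver.solve-∀
      shuffle₂ : ∀ pa F₁ F₂ U p m → pa ℕ.+ (F₁ ℕ.+ F₂ ℕ.+ U ℕ.+ 2 ℕ.* p ℕ.+ m) ≡ F₁ ℕ.+ F₂ ℕ.+ (U ℕ.+ pa) ℕ.+ 2 ℕ.* p ℕ.+ m
      shuffle₂ = ℕ-Solver.solve-∀

    peaks : List ℕ → ℕ
    peaks = exponent [x]

    exponent-degree-long : (r : List ℕ) → j ℕ.≤ length r →
      exponent [1+ωx] r ℕ.+ exponent [x+ω] r ℕ.+ countBy isAsc (window r) ℕ.+ 2 ℕ.* peaks r ℕ.+ j ≡ length r
    exponent-degree-long r j≤r =
      trans (cong (exponent [1+ωx] r ℕ.+ exponent [x+ω] r ℕ.+ countBy isAsc (window r) ℕ.+ 2 ℕ.* peaks r ℕ.+_) (sym (ℕP.m≥n⇒m⊓n≡n j≤r)))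
            (exponent-degree r)

    totalExponent : List ℕ → Base → ℕ
    totalExponent r e = exponent e r ℕ.+ countBy (windowExponent e) (window r)

    totalExponent-[x] : (r : List ℕ) → totalExponent r [x] ≡ exponent [x] r
    totalExponent-[x] r = trans (cong (exponent [x] r ℕ.+_) (countBy-zero (window r))) (ℕP.+-identityʳ _)

    totalExponent-[1+ω] : (r : List ℕ) → j ℕ.≤ length r → totalExponent r [1+ω] ≡ 2 ℕ.* exponent [x] r ℕ.+ j
    totalExponent-[1+ω] r j≤r = trans (exponent-[1+ω] r) (cong (2 ℕ.* exponent [x] r ℕ.+_) (ℕP.m≥n⇒m⊓n≡n j≤r))

    totalExponent-rest : (r : List ℕ) → j ℕ.≤ length r →
      totalExponent r [1+ωx] ℕ.+ totalExponent r [x+ω] ≡ length r ∸ j ∸ 2 ℕ.* exponent [x] r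
    totalExponent-rest r j≤r = begin
      E₁ ℕ.+ U ℕ.+ (E₂ ℕ.+ countBy (λ _ → 0) (window r))
        ≡⟨ cong (λ t → E₁ ℕ.+ U ℕ.+ (E₂ ℕ.+ t)) (countBy-zero (window r)) ⟩
      E₁ ℕ.+ U ℕ.+ (E₂ ℕ.+ 0)
        ≡⟨ sym (ℕP.m+n∸n≡m _ (j ℕ.+ 2 ℕ.* p)) ⟩
      E₁ ℕ.+ U ℕ.+ (E₂ ℕ.+ 0) ℕ.+ (j ℕ.+ 2 ℕ.* p) ∸ (j ℕ.+ 2 ℕ.* p)
        ≡⟨ cong (_∸ (j ℕ.+ 2 ℕ.* p)) (trans (shuffle E₁ U E₂ j p) (exponent-degree-long r j≤r)) ⟩
      length r ∸ (j ℕ.+ 2 ℕ.* p)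
        ≡⟨ sym (ℕP.∸-+-assoc (length r) j (2 ℕ.* p)) ⟩
      length r ∸ j ∸ 2 ℕ.* p ∎
      where
      open ≡-Reasoning
      E₁ = exponent [1+ωx] r
      E₂ = exponent [x+ω] r
      U = countBy isAsc (window r)
      p = exponent [x] r
      shuffle : ∀ E₁ U E₂ j p → E₁ ℕ.+ U ℕ.+ (E₂ ℕ.+ 0) ℕ.+ (j ℕ.+ 2 ℕ.* p) ≡ E₁ ℕ.+ E₂ ℕ.+ U ℕ.+ 2 ℕ.* p ℕ.+ j
      shuffle = ℕ-Solver.solve-∀

    peaks-bound : (r : List ℕ) → j ℕ.≤ length r → 2 ℕ.* peaks r ℕ.≤ length r ∸ j
    peaks-bound r j≤r = subst (2 ℕ.* peaks r ℕ.≤_) (sym (trans (cong (_∸ j) (sym (exponent-degree-long r j≤r))) (ℕP.m+n∸n≡m _ j)))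
      (ℕP.m≤n+m (2 ℕ.* peaks r) (exponent [1+ωx] r ℕ.+ exponent [x+ω] r ℕ.+ countBy isAsc (window r)))

    -- Whatever the sign of its partner, a negative entry of slope asc makes one descent more than
    -- a positive one and a negative entry of slope desc makes the same number; so once the signs
    -- to its left are summed out, the two signs of an entry weigh 1 : ψ s, and a weight g on its
    -- sign contributes close g s.  The window holds such weights for the last k entries.
    module Weights (x ω : ℤ) where

      ψ : Slope → ℤ
      ψ asc = ω * x
      ψ desc = ω

      close : (Bool → ℤ) → Slope → ℤ
      close g s = g false + g true * ψ s

      factorOf : Slope → Bool → ℤ
      factorOf asc c = if c then 1ℤ + ω * x else x * (1ℤ + ω)
      factorOf desc c = if c then 1ℤ + ω else x + ω

      factor : Partner → ℕ → ℤ
      factor origin b = 1ℤ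
      factor absent b = 1ℤ
      factor (entry v s) b = factorOf s (v ℕ.<ᵇ b)

      factors : List ℕ → ℤ
      factors [] = 1ℤ
      factors (b ∷ r) = factor (partner j (slopes r)) b * factors r

      closeWindow : List (Bool → ℤ) → List (ℕ × Slope) → ℤ
      closeWindow [] _ = 1ℤ
      closeWindow (g ∷ gs) [] = 1ℤ
      closeWindow (g ∷ gs) ((_ , s) ∷ L) = close g s * closeWindow gs L

      weigh : List (Bool → ℤ) → List Bool → ℤ
      weigh [] _ = 1ℤ
      weigh (g ∷ gs) [] = 1ℤ
      weigh (g ∷ gs) (e ∷ s) = g e * weigh gs s

      signWeight : List ℕ → List Bool → ℤ
      signWeight r s = ω ^ trues s * x ^ desRev (withSigns s r)

      weigh-∷ʳ : (gs : List (Bool → ℤ)) (h : Bool → ℤ) (s : List Bool) → length gs ℕ.< length s →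
        weigh (gs ++ [ h ]) s ≡ weigh gs s * h (nth false (length gs) s)
      weigh-∷ʳ [] h (e ∷ s) _ = trans (ℤP.*-identityʳ (h e)) (sym (ℤP.*-identityˡ (h e)))
      weigh-∷ʳ (g ∷ gs) h (e ∷ s) (s≤s lt) rewrite weigh-∷ʳ gs h s lt = sym (ℤP.*-assoc (g e) _ _)

      weigh-∷ʳ-short : (gs : List (Bool → ℤ)) (h : Bool → ℤ) (s : List Bool) → length s ℕ.≤ length gs →
        weigh (gs ++ [ h ]) s ≡ weigh gs s
      weigh-∷ʳ-short [] h [] _ = refl
      weigh-∷ʳ-short (g ∷ gs) h [] _ = refl
      weigh-∷ʳ-short (g ∷ gs) h (e ∷ s) (s≤s le) = cong (g e *_) (weigh-∷ʳ-short gs h s le)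

      closeWindow-∷ʳ : (gs : List (Bool → ℤ)) (h : Bool → ℤ) (L : List (ℕ × Slope)) (v : ℕ) (s : Slope) →
        partner (length gs) L ≡ entry v s → closeWindow (gs ++ [ h ]) L ≡ closeWindow gs L * close h s
      closeWindow-∷ʳ [] h ((v , s) ∷ L) .v .s refl = trans (ℤP.*-identityʳ _) (sym (ℤP.*-identityˡ _))
      closeWindow-∷ʳ (g ∷ gs) h ((_ , s′) ∷ L) v s e rewrite closeWindow-∷ʳ gs h L v s e = sym (ℤP.*-assoc (close g s′) _ _)

      closeWindow-∷ʳ-short : (gs : List (Bool → ℤ)) (h : Bool → ℤ) (L : List (ℕ × Slope)) → length L ℕ.≤ length gs →
        closeWindow (gs ++ [ h ]) L ≡ closeWindow gs L
      closeWindow-∷ʳ-short [] h [] _ = refl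
      closeWindow-∷ʳ-short (g ∷ gs) h [] _ = refl
      closeWindow-∷ʳ-short (g ∷ gs) h ((_ , s) ∷ L) (s≤s le) = cong (close g s *_) (closeWindow-∷ʳ-short gs h L le)

      newEntryWeight : (Bool → ℤ) → ℕ → Maybe ℤ → ℤ
      newEntryWeight g b m = g false * x ^ descentFrom m (+ b) + g true * ω * x ^ descentFrom m (- (+ b))

      deferred : (Bool → ℤ) → ℕ → ℕ → Bool → ℤ
      deferred g b v δ = newEntryWeight g b (just (signed δ v))

      close-deferred : (g : Bool → ℤ) (s : Slope) (v b : ℕ) → Positive v → Positive b → b ≢ v →
        close (deferred g b v) s ≡ factor (entry v s) b * close g (slopeAfter (entry v s) b)
      close-deferred g s (suc v) (suc b) _ _ b≢v with ℕP.<-cmp v b | s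
      ... | tri≈ _ refl _ | _ = ⊥-elim (b≢v refl)
      ... | tri< v<b _ _ | asc rewrite <ᵇ-false (ℕP.<⇒≤ v<b) | <ᵇ-true v<b = ascent-up (g false) (g true) x ω
        where
        ascent-up : ∀ a c x ω → (a * 1ℤ + c * ω * (x * 1ℤ)) + (a * 1ℤ + c * ω * (x * 1ℤ)) * (ω * x) ≡ (1ℤ + ω * x) * (a + c * (ω * x))
        ascent-up = solve-∀
      ... | tri> _ _ b<v | asc rewrite <ᵇ-true b<v | <ᵇ-false (ℕP.<⇒≤ b<v) = ascent-down (g false) (g true) x ω
        where
        ascent-down : ∀ a c x ω → (a * (x * 1ℤ) + c * ω * (x * 1ℤ)) + (a * 1ℤ + c * ω * 1ℤ) * (ω * x) ≡ x * (1ℤ + ω) * (a + c * ω)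
        ascent-down = solve-∀
      ... | tri< v<b _ _ | desc rewrite <ᵇ-false (ℕP.<⇒≤ v<b) | <ᵇ-true v<b = descent-up (g false) (g true) x ω
        where
        descent-up : ∀ a c x ω → (a * 1ℤ + c * ω * (x * 1ℤ)) + (a * 1ℤ + c * ω * (x * 1ℤ)) * ω ≡ (1ℤ + ω) * (a + c * (ω * x))
        descent-up = solve-∀
      ... | tri> _ _ b<v | desc rewrite <ᵇ-true b<v | <ᵇ-false (ℕP.<⇒≤ b<v) = descent-down (g false) (g true) x ω
        where
        descent-down : ∀ a c x ω → (a * (x * 1ℤ) + c * ω * (x * 1ℤ)) + (a * 1ℤ + c * ω * 1ℤ) * ω ≡ (x + ω) * (a + c * ω)
        descent-down = solve-∀

      newEntryWeight-origin : (g : Bool → ℤ) (b : ℕ) → Positive b →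
        newEntryWeight g b (just 0ℤ) ≡ factor origin b * close g (slopeAfter origin b)
      newEntryWeight-origin g (suc b) _ = normalise (g false) (g true) x ω
        where
        normalise : ∀ a c x ω → a * 1ℤ + c * ω * (x * 1ℤ) ≡ 1ℤ * (a + c * (ω * x))
        normalise = solve-∀

      newEntryWeight-absent : (g : Bool → ℤ) (b : ℕ) →
        newEntryWeight g b nothing ≡ factor absent b * close g (slopeAfter absent b)
      newEntryWeight-absent g b = normalise (g false) (g true) ω
        where
        normalise : ∀ a c ω → a * 1ℤ + c * ω * 1ℤ ≡ 1ℤ * (a + c * ω)
        normalise = solve-∀

      Factorises : List ℕ → Set
      Factorises r = (gs : List (Bool → ℤ)) → length gs ≡ suc j →
        ∑ (words bools (length r)) (λ s → weigh gs s * signWeight r s) ≡ factors r * closeWindow gs (slopes r)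

      ∑-first-sign : (g : Bool → ℤ) (gs : List (Bool → ℤ)) (b : ℕ) (r : List ℕ) →
        ∑ (words bools (suc (length r))) (λ s → weigh (g ∷ gs) s * signWeight (b ∷ r) s) ≡
        ∑ (words bools (length r)) (λ s → newEntryWeight g b (valueAt j (withSigns s r)) * weigh gs s * signWeight r s)
      ∑-first-sign g gs b r = begin
        ∑ (words bools (suc (length r))) (λ s → weigh (g ∷ gs) s * signWeight (b ∷ r) s)
          ≡⟨ ∑-bools-words-suc (length r) _ ⟩
        ∑ (words bools (length r)) (F false) + ∑ (words bools (length r)) (F true)
          ≡⟨ sym (∑-+ (words bools (length r)) _ _) ⟩
        ∑ (words bools (length r)) (λ s → F false s + F true s)
          ≡⟨ ∑-cong (words bools (length r)) collect ⟩
        ∑ (words bools (length r)) (λ s → newEntryWeight g b (valueAt j (withSigns s r)) * weigh gs s * signWeight r s) ∎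
        where
        open ≡-Reasoning
        F : Bool → List Bool → ℤ
        F e s = weigh (g ∷ gs) (e ∷ s) * signWeight (b ∷ r) (e ∷ s)
        regroup : ∀ a c W t d d′ X ω → a * W * (t * (d * X)) + c * W * (ω * t * (d′ * X)) ≡ (a * d + c * ω * d′) * W * (t * X)
        regroup = solve-∀
        collect : ∀ s → F false s + F true s ≡ newEntryWeight g b (valueAt j (withSigns s r)) * weigh gs s * signWeight r s
        collect s = begin
          F false s + F true s
            ≡⟨ cong₂ (λ p q → g false * weigh gs s * (ω ^ trues s * p) + g true * weigh gs s * (ω * ω ^ trues s * q))
                 (ℤP.^-distribˡ-+-* x (descentFrom m (+ b)) (desRev (withSigns s r)))
                 (ℤP.^-distribˡ-+-* x (descentFrom m (- (+ b))) (desRev (withSigns s r))) ⟩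
          _ ≡⟨ regroup (g false) (g true) (weigh gs s) (ω ^ trues s) _ _ (x ^ desRev (withSigns s r)) ω ⟩
          newEntryWeight g b m * weigh gs s * signWeight r s ∎
          where m = valueAt j (withSigns s r)

      length-∷ʳ : (gs : List (Bool → ℤ)) (h : Bool → ℤ) → length gs ≡ j → length (gs ++ [ h ]) ≡ suc j
      length-∷ʳ gs h refl = trans (List.length-++ gs) (ℕP.+-comm (length gs) 1)

      step-entry : (g : Bool → ℤ) (gs : List (Bool → ℤ)) (b : ℕ) (r : List ℕ) → length gs ≡ j →
        Positive b → All Positive r → All (b ≢_) r → j ℕ.< length r → Factorises r →
        ∑ (words bools (length r)) (λ s → newEntryWeight g b (valueAt j (withSigns s r)) * weigh gs s * signWeight r s)
        ≡ factors (b ∷ r) * closeWindow (g ∷ gs) (slopes (b ∷ r))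
      step-entry g gs b r refl pb pr b≢r j<r ih = begin
        ∑ (words bools (length r)) (λ t → newEntryWeight g b (valueAt j (withSigns t r)) * weigh gs t * signWeight r t)
          ≡⟨ ∑-words-cong bools bools-All (length r) (λ t lt _ → defer t lt) ⟩
        ∑ (words bools (length r)) (λ t → weigh (gs ++ [ h ]) t * signWeight r t)
          ≡⟨ ih (gs ++ [ h ]) (length-∷ʳ gs h refl) ⟩
        factors r * closeWindow (gs ++ [ h ]) L
          ≡⟨ cong (factors r *_) (closeWindow-∷ʳ gs h L v s partner≡) ⟩
        factors r * (closeWindow gs L * close h s)
          ≡⟨ cong (λ t → factors r * (closeWindow gs L * t)) (close-deferred g s v b (nth-All j r pr j<r) pb (nth-All j r b≢r j<r)) ⟩
        factors r * (closeWindow gs L * (factor (entry v s) b * close g (slopeAfter (entry v s) b)))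
          ≡⟨ regroup (factors r) (closeWindow gs L) (factor (entry v s) b) (close g (slopeAfter (entry v s) b)) ⟩
        factor (entry v s) b * factors r * (close g (slopeAfter (entry v s) b) * closeWindow gs L)
          ≡⟨ cong (λ p → factor p b * factors r * (close g (slopeAfter p b) * closeWindow gs L)) (sym partner≡) ⟩
        factors (b ∷ r) * closeWindow (g ∷ gs) (slopes (b ∷ r)) ∎
        where
        open ≡-Reasoning
        L = slopes r
        v = nth 0 j r
        s = slopeAfter (partner j (slopes (drop (suc j) r))) v
        partner≡ : partner j L ≡ entry v s
        partner≡ = partner-slopes j r j<r
        h = deferred g b v
        regroup : ∀ C W F S → C * (W * (F * S)) ≡ F * C * (S * W)
        regroup = solve-∀
        defer : ∀ t → length t ≡ length r →
          newEntryWeight g b (valueAt j (withSigns t r)) * weigh gs t * signWeight r t ≡ weigh (gs ++ [ h ]) t * signWeight r t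
        defer t lt = begin
          newEntryWeight g b (valueAt j (withSigns t r)) * weigh gs t * signWeight r t
            ≡⟨ cong (λ m → newEntryWeight g b m * weigh gs t * signWeight r t) (valueAt-withSigns j t r lt j<r) ⟩
          h (nth false j t) * weigh gs t * signWeight r t
            ≡⟨ cong (_* signWeight r t) (ℤP.*-comm (h (nth false j t)) _) ⟩
          weigh gs t * h (nth false (length gs) t) * signWeight r t
            ≡⟨ cong (_* signWeight r t) (sym (weigh-∷ʳ gs h t (subst (j ℕ.<_) (sym lt) j<r))) ⟩
          weigh (gs ++ [ h ]) t * signWeight r t ∎

      one : Bool → ℤ
      one _ = 1ℤ

      step-boundary : (g : Bool → ℤ) (gs : List (Bool → ℤ)) (b : ℕ) (r : List ℕ) → length gs ≡ j →
        (m : Maybe ℤ) (p : Partner) → length r ℕ.≤ j →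
        (∀ t → length t ≡ length r → valueAt j (withSigns t r) ≡ m) → partner j (slopes r) ≡ p →
        newEntryWeight g b m ≡ factor p b * close g (slopeAfter p b) → Factorises r →
        ∑ (words bools (length r)) (λ s → newEntryWeight g b (valueAt j (withSigns s r)) * weigh gs s * signWeight r s)
        ≡ factors (b ∷ r) * closeWindow (g ∷ gs) (slopes (b ∷ r))
      step-boundary g gs b r refl m p r≤j value≡ partner≡ weight≡ ih = begin
        ∑ (words bools (length r)) (λ t → newEntryWeight g b (valueAt j (withSigns t r)) * weigh gs t * signWeight r t)
          ≡⟨ ∑-words-cong bools bools-All (length r) (λ t lt _ → constant t lt) ⟩
        ∑ (words bools (length r)) (λ t → newEntryWeight g b m * (weigh (gs ++ [ one ]) t * signWeight r t))
          ≡⟨ sym (∑-*ˡ (newEntryWeight g b m) (words bools (length r)) _) ⟩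
        newEntryWeight g b m * ∑ (words bools (length r)) (λ t → weigh (gs ++ [ one ]) t * signWeight r t)
          ≡⟨ cong (newEntryWeight g b m *_) (ih (gs ++ [ one ]) (length-∷ʳ gs one refl)) ⟩
        newEntryWeight g b m * (factors r * closeWindow (gs ++ [ one ]) L)
          ≡⟨ cong (λ t → newEntryWeight g b m * (factors r * t)) (closeWindow-∷ʳ-short gs one L (subst (ℕ._≤ j) (sym (length-slopes r)) r≤j)) ⟩
        newEntryWeight g b m * (factors r * closeWindow gs L)
          ≡⟨ cong (_* (factors r * closeWindow gs L)) weight≡ ⟩
        factor p b * close g (slopeAfter p b) * (factors r * closeWindow gs L)
          ≡⟨ regroup (factor p b) (close g (slopeAfter p b)) (factors r) (closeWindow gs L) ⟩
        factor p b * factors r * (close g (slopeAfter p b) * closeWindow gs L)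
          ≡⟨ cong (λ p → factor p b * factors r * (close g (slopeAfter p b) * closeWindow gs L)) (sym partner≡) ⟩
        factors (b ∷ r) * closeWindow (g ∷ gs) (slopes (b ∷ r)) ∎
        where
        open ≡-Reasoning
        L = slopes r
        regroup : ∀ F S C W → F * S * (C * W) ≡ F * C * (S * W)
        regroup = solve-∀
        constant : ∀ t → length t ≡ length r →
          newEntryWeight g b (valueAt j (withSigns t r)) * weigh gs t * signWeight r t ≡ newEntryWeight g b m * (weigh (gs ++ [ one ]) t * signWeight r t)
        constant t lt = begin
          newEntryWeight g b (valueAt j (withSigns t r)) * weigh gs t * signWeight r t
            ≡⟨ cong (λ m′ → newEntryWeight g b m′ * weigh gs t * signWeight r t) (value≡ t lt) ⟩
          newEntryWeight g b m * weigh gs t * signWeight r t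
            ≡⟨ ℤP.*-assoc (newEntryWeight g b m) _ _ ⟩
          newEntryWeight g b m * (weigh gs t * signWeight r t)
            ≡⟨ cong (λ w → newEntryWeight g b m * (w * signWeight r t)) (sym (weigh-∷ʳ-short gs one t (subst (ℕ._≤ j) (sym lt) r≤j))) ⟩
          newEntryWeight g b m * (weigh (gs ++ [ one ]) t * signWeight r t) ∎

      factorises : (r : List ℕ) → AllPairs _≢_ r → All Positive r → Factorises r
      factorises [] _ _ (g ∷ gs) _ = refl
      factorises (b ∷ r) (b≢r ∷ distinct) (pb ∷ pr) (g ∷ gs) lgs =
        trans (∑-first-sign g gs b r) (by-partner (ℕP.<-cmp j (length r)))
        where
        lgs′ : length gs ≡ j
        lgs′ = ℕP.suc-injective lgs
        ih : Factorises r
        ih = factorises r distinct pr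
        by-partner : Tri (j ℕ.< length r) (j ≡ length r) (j ℕ.> length r) →
          ∑ (words bools (length r)) (λ s → newEntryWeight g b (valueAt j (withSigns s r)) * weigh gs s * signWeight r s)
          ≡ factors (b ∷ r) * closeWindow (g ∷ gs) (slopes (b ∷ r))
        by-partner (tri< j<r _ _) = step-entry g gs b r lgs′ pb pr b≢r j<r ih
        by-partner (tri≈ _ j≡r _) = step-boundary g gs b r lgs′ (just 0ℤ) origin (ℕP.≤-reflexive (sym j≡r))
          (λ t lt → valueAt-origin j (withSigns t r) (trans (length-withSigns t r lt) (sym j≡r)))
          (partner-origin j (slopes r) (trans (length-slopes r) (sym j≡r))) (newEntryWeight-origin g b pb) ih
        by-partner (tri> _ _ r<j) = step-boundary g gs b r lgs′ nothing absent (ℕP.<⇒≤ r<j)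
          (λ t lt → valueAt-absent j (withSigns t r) (subst (ℕ._< j) (sym (length-withSigns t r lt)) r<j))
          (partner-absent j (slopes r) (subst (ℕ._< j) (sym (length-slopes r)) r<j)) (newEntryWeight-absent g b) ih

      base : Base → ℤ
      base [1+ω] = 1ℤ + ω
      base [x] = x
      base [1+ωx] = 1ℤ + ω * x
      base [x+ω] = x + ω

      monomial : (Base → ℕ) → ℤ
      monomial d = base [1+ω] ^ d [1+ω] * base [x] ^ d [x] * base [1+ωx] ^ d [1+ωx] * base [x+ω] ^ d [x+ω]

      monomial-+ : (d d′ : Base → ℕ) → monomial d * monomial d′ ≡ monomial (λ e → d e ℕ.+ d′ e)
      monomial-+ d d′
        rewrite ℤP.^-distribˡ-+-* (base [1+ω]) (d [1+ω]) (d′ [1+ω]) | ℤP.^-distribˡ-+-* (base [x]) (d [x]) (d′ [x])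
              | ℤP.^-distribˡ-+-* (base [1+ωx]) (d [1+ωx]) (d′ [1+ωx]) | ℤP.^-distribˡ-+-* (base [x+ω]) (d [x+ω]) (d′ [x+ω]) =
        interchange (base [1+ω] ^ d [1+ω]) (base [x] ^ d [x]) (base [1+ωx] ^ d [1+ωx]) (base [x+ω] ^ d [x+ω])
                    (base [1+ω] ^ d′ [1+ω]) (base [x] ^ d′ [x]) (base [1+ωx] ^ d′ [1+ωx]) (base [x+ω] ^ d′ [x+ω])
        where
        interchange : ∀ a b c d a′ b′ c′ d′ → a * b * c * d * (a′ * b′ * c′ * d′) ≡ a * a′ * (b * b′) * (c * c′) * (d * d′)
        interchange = solve-∀

      factor-monomial : (P : Partner) (b : ℕ) → factor P b ≡ monomial (λ e → partnerExponent e P b)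
      factor-monomial origin b = refl
      factor-monomial absent b = refl
      factor-monomial (entry v s) b with s | v ℕ.<ᵇ b
      ... | asc | true = normalise x ω
        where
        normalise : ∀ x ω → 1ℤ + ω * x ≡ 1ℤ * 1ℤ * ((1ℤ + ω * x) * 1ℤ) * 1ℤ
        normalise = solve-∀
      ... | asc | false = normalise x ω
        where
        normalise : ∀ x ω → x * (1ℤ + ω) ≡ (1ℤ + ω) * 1ℤ * (x * 1ℤ) * 1ℤ * 1ℤ
        normalise = solve-∀
      ... | desc | true = normalise x ω
        where
        normalise : ∀ x ω → 1ℤ + ω ≡ (1ℤ + ω) * 1ℤ * 1ℤ * 1ℤ * 1ℤ
        normalise = solve-∀
      ... | desc | false = normalise x ω
        where
        normalise : ∀ x ω → x + ω ≡ 1ℤ * 1ℤ * 1ℤ * ((x + ω) * 1ℤ)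
        normalise = solve-∀

      factors-monomial : (r : List ℕ) → factors r ≡ monomial (λ e → exponent e r)
      factors-monomial [] = refl
      factors-monomial (b ∷ r) =
        trans (cong₂ _*_ (factor-monomial (partner j (slopes r)) b) (factors-monomial r)) (monomial-+ (λ e → partnerExponent e (partner j (slopes r)) b) (λ e → exponent e r))

      close-one : (s : Slope) → close one s ≡ monomial (λ e → windowExponent e s)
      close-one asc = normalise x ω
        where
        normalise : ∀ x ω → 1ℤ + 1ℤ * (ω * x) ≡ 1ℤ * 1ℤ * ((1ℤ + ω * x) * 1ℤ) * 1ℤ
        normalise = solve-∀
      close-one desc = normalise ω
        where
        normalise : ∀ ω → 1ℤ + 1ℤ * ω ≡ (1ℤ + ω) * 1ℤ * 1ℤ * 1ℤ * 1ℤ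
        normalise = solve-∀

      closeWindow-ones : (n : ℕ) (L : List (ℕ × Slope)) →
        closeWindow (replicate n one) L ≡ monomial (λ e → countBy (windowExponent e) (take n L))
      closeWindow-ones zero L = refl
      closeWindow-ones (suc n) [] = refl
      closeWindow-ones (suc n) ((_ , s) ∷ L) =
        trans (cong₂ _*_ (close-one s) (closeWindow-ones n L)) (monomial-+ (λ e → windowExponent e s) (λ e → countBy (windowExponent e) (take n L)))

      factorised-form : (r : List ℕ) →
        factors r * closeWindow (replicate (suc j) one) (slopes r) ≡ monomial (totalExponent r)
      factorised-form r = trans (cong₂ _*_ (factors-monomial r) (closeWindow-ones (suc j) (slopes r))) (monomial-+ (λ e → exponent e r) (λ e → countBy (windowExponent e) (window r)))

      weigh-ones : (n : ℕ) (s : List Bool) → weigh (replicate n one) s ≡ 1ℤ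
      weigh-ones zero s = refl
      weigh-ones (suc n) [] = refl
      weigh-ones (suc n) (e ∷ s) = trans (ℤP.*-identityˡ _) (weigh-ones n s)

      ∑-signWeight : (r : List ℕ) → AllPairs _≢_ r → All Positive r →
        ∑ (words bools (length r)) (signWeight r) ≡ monomial (totalExponent r)
      ∑-signWeight r distinct positive = begin
        ∑ (words bools (length r)) (signWeight r)
          ≡⟨ ∑-cong (words bools (length r)) (λ s → sym (trans (cong (_* signWeight r s) (weigh-ones (suc j) s)) (ℤP.*-identityˡ _))) ⟩
        ∑ (words bools (length r)) (λ s → weigh (replicate (suc j) one) s * signWeight r s)
          ≡⟨ factorises r distinct positive (replicate (suc j) one) (List.length-replicate (suc j)) ⟩
        factors r * closeWindow (replicate (suc j) one) (slopes r)
          ≡⟨ factorised-form r ⟩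
        monomial (totalExponent r) ∎
        where open ≡-Reasoning

  ∸-position : (i n j : ℕ) → i ℕ.+ suc j ≡ suc n → j ℕ.≤ n × n ∸ j ≡ i
  ∸-position i n j e = j≤n , trans (cong (_∸ j) (sym i+j≡n)) (ℕP.m+n∸n≡m i j)
    where
    i+j≡n : i ℕ.+ j ≡ n
    i+j≡n = ℕP.suc-injective (trans (sym (ℕP.+-suc i j)) e)
    j≤n : j ℕ.≤ n
    j≤n = subst (j ℕ.≤_) i+j≡n (ℕP.m≤n+m j i)

  ∸-position⁻¹ : (n j : ℕ) → j ℕ.≤ n → (n ∸ j) ℕ.+ suc j ≡ suc n
  ∸-position⁻¹ n j j≤n = trans (ℕP.+-suc (n ∸ j) j) (cong suc (ℕP.m∸n+n≡m j≤n))

  -- Counts are taken in ℤ, so that the lemmas on ∑ apply to them.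
  module WindowSum {X : Set} (z : X) where

    at-∷ʳ : (w : List X) (y : X) (t : ℕ) → t ℕ.≤ length w → at z (w ++ [ y ]) t ≡ at z w t
    at-∷ʳ w y zero _ = refl
    at-∷ʳ (x ∷ w) y (suc zero) _ = refl
    at-∷ʳ (x ∷ w) y (suc (suc t)) (s≤s le) = at-∷ʳ w y (suc t) le

    at-∷ʳ-last : (w : List X) (y : X) → at z (w ++ [ y ]) (suc (length w)) ≡ y
    at-∷ʳ-last [] y = refl
    at-∷ʳ-last (x ∷ w) y = at-∷ʳ-last w y

    Test : Set
    Test = ℕ → X → (ℕ → X) → Bool

    Local : Test → Set
    Local F = ∀ i v (g g′ : ℕ → X) → (∀ t → t ℕ.≤ i → g t ≡ g′ t) → F i v g ≡ F i v g′

    hits : ℕ → ℕ → Test → List X → ℕ → ℤ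
    hits N k F w i = guard (does (i ℕ.+ k ℕ.≤? N) ∧ F i (at z w (i ℕ.+ k)) (at z w)) 1ℤ

    windowSum : ℕ → ℕ → Test → List X → ℤ
    windowSum N k F w = ∑ (upTo (suc N)) (hits N k F w)

    module _ (F : Test) (local : Local F) (n j : ℕ) (w : List X) (y : X) (lw : length w ≡ n) where

      private
        k = suc j
        w′ = w ++ [ y ]
        last : ℕ → ℤ
        last i = guard (F i y (at z w)) 1ℤ
        newHit : ℕ → ℤ
        newHit i = guard (does (j ℕ.≤? n)) (guard (does (n ∸ j ℕ.≟ i)) (last i))

        local-∷ʳ : ∀ i v → i ℕ.< suc n → F i v (at z w′) ≡ F i v (at z w)
        local-∷ʳ i v i<1+n = local i v _ _ (λ t t≤i → at-∷ʳ w y t (subst (t ℕ.≤_) (sym lw) (ℕP.≤-trans t≤i (ℕP.≤-pred i<1+n))))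

        newHit-none : ∀ i → (j ℕ.≤ n → n ∸ j ≢ i) → newHit i ≡ 0ℤ
        newHit-none i ne with j ℕ.≤? n
        ... | no j≰n = cong (λ b → guard b (guard (does (n ∸ j ℕ.≟ i)) (last i))) (dec-false (j ℕ.≤? n) j≰n)
        ... | yes j≤n = trans (cong (λ b → guard b (guard (does (n ∸ j ℕ.≟ i)) (last i))) (dec-true (j ℕ.≤? n) j≤n))
                              (cong (λ b → guard b (last i)) (dec-false (n ∸ j ℕ.≟ i) (ne j≤n)))

        hits-∷ʳ : ∀ i → i ℕ.< suc n → hits (suc n) k F w′ i ≡ hits n k F w i + newHit i
        hits-∷ʳ i i<1+n with ℕP.<-cmp (i ℕ.+ k) (suc n)
        ... | tri< i+k<1+n _ _ = begin
          guard (does (i ℕ.+ k ℕ.≤? suc n) ∧ F i (at z w′ (i ℕ.+ k)) (at z w′)) 1ℤ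
            ≡⟨ cong₂ (λ b c → guard (b ∧ c) 1ℤ) (dec-true (i ℕ.+ k ℕ.≤? suc n) (ℕP.<⇒≤ i+k<1+n))
                 (trans (cong (λ v → F i v (at z w′)) (at-∷ʳ w y (i ℕ.+ k) (subst (i ℕ.+ k ℕ.≤_) (sym lw) (ℕP.≤-pred i+k<1+n))))
                        (local-∷ʳ i _ i<1+n)) ⟩
          guard (true ∧ F i (at z w (i ℕ.+ k)) (at z w)) 1ℤ
            ≡⟨ cong (λ b → guard (b ∧ F i (at z w (i ℕ.+ k)) (at z w)) 1ℤ) (sym (dec-true (i ℕ.+ k ℕ.≤? n) (ℕP.≤-pred i+k<1+n))) ⟩
          hits n k F w i
            ≡⟨ sym (trans (cong (_+_ (hits n k F w i)) (newHit-none i (λ j≤n e → ℕP.<-irrefl (trans (sym (cong (ℕ._+ k) e)) (∸-position⁻¹ n j j≤n)) i+k<1+n)))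
                          (ℤP.+-identityʳ _)) ⟩
          hits n k F w i + newHit i ∎
          where open ≡-Reasoning
        ... | tri≈ _ i+k≡1+n _ = begin
          guard (does (i ℕ.+ k ℕ.≤? suc n) ∧ F i (at z w′ (i ℕ.+ k)) (at z w′)) 1ℤ
            ≡⟨ cong₂ (λ b c → guard (b ∧ c) 1ℤ) (dec-true (i ℕ.+ k ℕ.≤? suc n) (ℕP.≤-reflexive i+k≡1+n))
                 (trans (cong (λ t → F i (at z w′ t) (at z w′)) (trans i+k≡1+n (cong suc (sym lw))))
                        (trans (cong (λ v → F i v (at z w′)) (at-∷ʳ-last w y)) (local-∷ʳ i y i<1+n))) ⟩
          last i
            ≡⟨ sym (trans (cong (λ b → guard b (guard (does (n ∸ j ℕ.≟ i)) (last i))) (dec-true (j ℕ.≤? n) j≤n))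
                          (cong (λ b → guard b (last i)) (dec-true (n ∸ j ℕ.≟ i) i≡)) ) ⟩
          newHit i
            ≡⟨ sym (trans (cong (λ b → guard (b ∧ F i (at z w (i ℕ.+ k)) (at z w)) 1ℤ + newHit i)
                                (dec-false (i ℕ.+ k ℕ.≤? n) (λ le → ℕP.<-irrefl i+k≡1+n (s≤s le))))
                          (ℤP.+-identityˡ _)) ⟩
          hits n k F w i + newHit i ∎
          where
          open ≡-Reasoning
          j≤n = proj₁ (∸-position i n j i+k≡1+n)
          i≡ = proj₂ (∸-position i n j i+k≡1+n)
        ... | tri> _ _ i+k>1+n = begin
          guard (does (i ℕ.+ k ℕ.≤? suc n) ∧ F i (at z w′ (i ℕ.+ k)) (at z w′)) 1ℤ
            ≡⟨ cong (λ b → guard (b ∧ F i (at z w′ (i ℕ.+ k)) (at z w′)) 1ℤ) (dec-false (i ℕ.+ k ℕ.≤? suc n) (ℕP.<⇒≱ i+k>1+n)) ⟩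
          0ℤ
            ≡⟨ sym (cong₂ _+_ (cong (λ b → guard (b ∧ F i (at z w (i ℕ.+ k)) (at z w)) 1ℤ)
                                     (dec-false (i ℕ.+ k ℕ.≤? n) (λ le → ℕP.<⇒≱ i+k>1+n (ℕP.m≤n⇒m≤1+n le))))
                               (newHit-none i (λ j≤n e → ℕP.<-irrefl (sym (trans (sym (cong (ℕ._+ k) e)) (∸-position⁻¹ n j j≤n))) i+k>1+n))) ⟩
          hits n k F w i + newHit i ∎
          where open ≡-Reasoning

      windowSum-∷ʳ : windowSum (suc n) k F w′ ≡ windowSum n k F w + guard (does (j ℕ.≤? n)) (last (n ∸ j))
      windowSum-∷ʳ = begin
        ∑ (upTo (suc (suc n))) (hits (suc n) k F w′)
          ≡⟨ ∑-upTo-∷ʳ (suc n) (hits (suc n) k F w′) ⟩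
        ∑ (upTo (suc n)) (hits (suc n) k F w′) + hits (suc n) k F w′ (suc n)
          ≡⟨ cong (λ b → ∑ (upTo (suc n)) (hits (suc n) k F w′) + guard (b ∧ F (suc n) (at z w′ (suc n ℕ.+ k)) (at z w′)) 1ℤ)
               (dec-false (suc n ℕ.+ k ℕ.≤? suc n) (ℕP.<⇒≱ (ℕP.m<m+n (suc n) (s≤s z≤n)))) ⟩
        ∑ (upTo (suc n)) (hits (suc n) k F w′) + 0ℤ
          ≡⟨ ℤP.+-identityʳ _ ⟩
        ∑ (upTo (suc n)) (hits (suc n) k F w′)
          ≡⟨ ∑-cong-All (All.map (λ {i} → hits-∷ʳ i) (All.all-upTo (suc n))) ⟩
        ∑ (upTo (suc n)) (λ i → hits n k F w i + newHit i)
          ≡⟨ ∑-+ (upTo (suc n)) (hits n k F w) newHit ⟩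
        windowSum n k F w + ∑ (upTo (suc n)) newHit
          ≡⟨ cong (_+_ (windowSum n k F w)) (∑-guard (does (j ℕ.≤? n)) (upTo (suc n)) (λ i → guard (does (n ∸ j ℕ.≟ i)) (last i))) ⟩
        windowSum n k F w + guard (does (j ℕ.≤? n)) (∑ (upTo (suc n)) (λ i → guard (does (n ∸ j ℕ.≟ i)) (last i)))
          ≡⟨ cong (λ t → windowSum n k F w + guard (does (j ℕ.≤? n)) t) (∑-upTo-δ (suc n) (n ∸ j) last (s≤s (ℕP.m∸n≤m n j))) ⟩
        windowSum n k F w + guard (does (j ℕ.≤? n)) (last (n ∸ j)) ∎
        where open ≡-Reasoning

  All-reverse : {P : A → Set} (xs : List A) → All P xs → All P (reverse xs)
  All-reverse [] [] = []
  All-reverse {P = P} (x ∷ xs) (p ∷ ps) = subst (All P) (sym (List.unfold-reverse x xs)) (All.∷ʳ⁺ (All-reverse xs ps) p)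

  AllPairs-reverse : (xs : List A) → AllPairs _≢_ xs → AllPairs _≢_ (reverse xs)
  AllPairs-reverse [] [] = []
  AllPairs-reverse (x ∷ xs) (x∉xs ∷ ps) = subst (AllPairs _≢_) (sym (List.unfold-reverse x xs))
    (AllPairs.++⁺ (AllPairs-reverse xs ps) ([] ∷ []) (All-reverse xs (All.map (λ x≢y → (λ y≡x → x≢y (sym y≡x)) ∷ []) x∉xs)))

  at-reverse : (z : A) (l : List A) (i : ℕ) → i ℕ.≤ length l → at z (reverse l) (length l ∸ i) ≡ nth z i l
  at-reverse z [] zero _ = refl
  at-reverse z (y ∷ l) zero _ = begin
    at z (reverse (y ∷ l)) (suc (length l))      ≡⟨ cong (λ w → at z w (suc (length l))) (List.unfold-reverse y l) ⟩
    at z (reverse l ++ [ y ]) (suc (length l))   ≡⟨ cong (λ t → at z (reverse l ++ [ y ]) (suc t)) (sym (List.length-reverse l)) ⟩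
    at z (reverse l ++ [ y ]) (suc (length (reverse l))) ≡⟨ WindowSum.at-∷ʳ-last z (reverse l) y ⟩
    y ∎
    where open ≡-Reasoning
  at-reverse z (y ∷ l) (suc i) (s≤s i≤l) = begin
    at z (reverse (y ∷ l)) (length l ∸ i)        ≡⟨ cong (λ w → at z w (length l ∸ i)) (List.unfold-reverse y l) ⟩
    at z (reverse l ++ [ y ]) (length l ∸ i)     ≡⟨ WindowSum.at-∷ʳ z (reverse l) y (length l ∸ i)
                                                      (subst (length l ∸ i ℕ.≤_) (sym (List.length-reverse l)) (ℕP.m∸n≤m (length l) i)) ⟩
    at z (reverse l) (length l ∸ i)              ≡⟨ at-reverse z l i i≤l ⟩
    nth z i l ∎
    where open ≡-Reasoning

  valueAt-nth : (i : ℕ) (l : List ℤ) → i ℕ.≤ length l → valueAt i l ≡ just (nth 0ℤ i l)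
  valueAt-nth zero [] _ = refl
  valueAt-nth zero (y ∷ l) _ = refl
  valueAt-nth (suc i) (y ∷ l) (s≤s i≤l) = valueAt-nth i l i≤l

  guard-bit : (b : Bool) → guard b 1ℤ ≡ + bit b
  guard-bit true = refl
  guard-bit false = refl

  open WindowSum using (windowSum; windowSum-∷ʳ)

  isDescentAt : ℕ → ℤ → (ℕ → ℤ) → Bool
  isDescentAt i v g = does (v ℤ.<? g i)

  desD-windowSum : (n k : ℕ) (w : List ℤ) → + desD n k w ≡ windowSum (+ 0) n k isDescentAt w
  desD-windowSum n k w = length-filter-∑ (λ i → (i ℕ.+ k ℕ.≤? n) ×-dec (at (+ 0) w (i ℕ.+ k) ℤ.<? at (+ 0) w i)) (upTo (suc n))

  desD-reverse : (j : ℕ) (w : List ℤ) → desD (length w) (suc j) (reverse w) ≡ Transfer.desRev j w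
  desD-reverse j [] = refl
  desD-reverse j (y ∷ w) = ℤP.+-injective (begin
    + desD (suc n) (suc j) (reverse (y ∷ w))
      ≡⟨ cong (λ v → + desD (suc n) (suc j) v) (List.unfold-reverse y w) ⟩
    + desD (suc n) (suc j) (reverse w ++ [ y ])
      ≡⟨ desD-windowSum (suc n) (suc j) _ ⟩
    windowSum (+ 0) (suc n) (suc j) isDescentAt (reverse w ++ [ y ])
      ≡⟨ windowSum-∷ʳ (+ 0) isDescentAt (λ i v g g′ g≗g′ → cong (λ t → does (v ℤ.<? t)) (g≗g′ i ℕP.≤-refl)) n j (reverse w) y (List.length-reverse w) ⟩
    windowSum (+ 0) n (suc j) isDescentAt (reverse w) + new
      ≡⟨ cong (_+ new) (sym (desD-windowSum n (suc j) (reverse w))) ⟩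
    + desD n (suc j) (reverse w) + new
      ≡⟨ cong₂ _+_ (cong +_ (desD-reverse j w)) new≡ ⟩
    + Transfer.desRev j w + + descentFrom (valueAt j w) y
      ≡⟨ trans (ℤP.+-comm (+ Transfer.desRev j w) (+ descentFrom (valueAt j w) y)) (sym (ℤP.pos-+ (descentFrom (valueAt j w) y) _)) ⟩
    + Transfer.desRev j (y ∷ w) ∎)
    where
    open ≡-Reasoning
    n = length w
    new = guard (does (j ℕ.≤? n)) (guard (isDescentAt (n ∸ j) y (at (+ 0) (reverse w))) 1ℤ)
    new≡ : new ≡ + descentFrom (valueAt j w) y
    new≡ with j ℕ.≤? n
    ... | yes j≤n = begin
      new
        ≡⟨ cong (λ b → guard b (guard (does (y ℤ.<? at (+ 0) (reverse w) (n ∸ j))) 1ℤ)) (dec-true (j ℕ.≤? n) j≤n) ⟩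
      guard (does (y ℤ.<? at (+ 0) (reverse w) (n ∸ j))) 1ℤ
        ≡⟨ cong (λ t → guard (does (y ℤ.<? t)) 1ℤ) (at-reverse (+ 0) w j j≤n) ⟩
      guard (does (y ℤ.<? nth 0ℤ j w)) 1ℤ
        ≡⟨ guard-bit _ ⟩
      + descentFrom (just (nth 0ℤ j w)) y
        ≡⟨ cong (λ m → + descentFrom m y) (sym (valueAt-nth j w j≤n)) ⟩
      + descentFrom (valueAt j w) y ∎
    ... | no j≰n = trans (cong (λ b → guard b (guard (does (y ℤ.<? at (+ 0) (reverse w) (n ∸ j))) 1ℤ)) (dec-false (j ℕ.≤? n) j≰n))
                         (cong (λ m → + descentFrom m y) (sym (valueAt-absent j w (ℕP.≰⇒> j≰n))))

  isPeakAt : ℕ → ℕ → ℕ → (ℕ → ℕ) → Bool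
  isPeakAt k i v g = does (k ℕ.≤? i) ∧ (does (g (i ∸ k) ℕ.<? g i) ∧ does (v ℕ.<? g i))

  isPeakAt-local : (k : ℕ) → WindowSum.Local 0 (isPeakAt k)
  isPeakAt-local k i v g g′ g≗g′ =
    cong₂ (λ a c → does (k ℕ.≤? i) ∧ (does (a ℕ.<? c) ∧ does (v ℕ.<? c))) (g≗g′ (i ∸ k) (ℕP.m∸n≤m i k)) (g≗g′ i ℕP.≤-refl)

  ∧-swap : (a b c : Bool) → a ∧ (b ∧ c) ≡ b ∧ (a ∧ c)
  ∧-swap true b c = refl
  ∧-swap false true c = refl
  ∧-swap false false c = refl

  lpeak-windowSum : (n k : ℕ) (s : List ℕ) → + lpeak n k s ≡ windowSum 0 n k (isPeakAt k) s
  lpeak-windowSum n k s = trans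
    (length-filter-∑ (λ i → (k ℕ.≤? i) ×-dec ((i ℕ.+ k ℕ.≤? n) ×-dec ((at 0 s (i ∸ k) ℕ.<? at 0 s i) ×-dec (at 0 s (i ℕ.+ k) ℕ.<? at 0 s i)))) (upTo (suc n)))
    (∑-cong (upTo (suc n)) (λ i → cong (λ b → guard b 1ℤ) (∧-swap (does (k ℕ.≤? i)) (does (i ℕ.+ k ℕ.≤? n)) _)))

  nth-drop : (d : A) (m i : ℕ) (l : List A) → nth d i (drop m l) ≡ nth d (m ℕ.+ i) l
  nth-drop d zero i l = refl
  nth-drop d (suc m) i [] = refl
  nth-drop d (suc m) i (_ ∷ l) = nth-drop d m i l

  <ᵇ-flip : (b v : ℕ) → b ≢ v → not (v ℕ.<ᵇ b) ≡ (b ℕ.<ᵇ v)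
  <ᵇ-flip b v b≢v with ℕP.<-cmp b v
  ... | tri< b<v _ _ = trans (cong not (<ᵇ-false (ℕP.<⇒≤ b<v))) (sym (<ᵇ-true b<v))
  ... | tri≈ _ b≡v _ = ⊥-elim (b≢v b≡v)
  ... | tri> _ _ b>v = trans (cong not (<ᵇ-true b>v)) (sym (<ᵇ-false (ℕP.<⇒≤ b>v)))

  stepExponent-[x]-slopeOf : (c d : Bool) → stepExponent [x] (slopeOf c) d ≡ bit (c ∧ not d)
  stepExponent-[x]-slopeOf true d = refl
  stepExponent-[x]-slopeOf false d = refl

  module Peaks (j : ℕ) where
    open Transfer j using (slopes; length-slopes; partner-slopes; exponent)

    ∸≡suc∸suc : (j n : ℕ) → j ℕ.< n → n ∸ j ≡ suc (n ∸ suc j)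
    ∸≡suc∸suc zero (suc n) _ = refl
    ∸≡suc∸suc (suc j) (suc n) (s≤s j<n) = ∸≡suc∸suc j n j<n

    peak-test : (b v : ℕ) (tail : List ℕ) (g : ℕ → ℕ) (i : ℕ) → i ≡ suc (length tail) → Positive v → b ≢ v →
      g 0 ≡ 0 → (j ℕ.< length tail → g (i ∸ suc j) ≡ nth 0 j tail) →
      bit (does (suc j ℕ.≤? i) ∧ (does (g (i ∸ suc j) ℕ.<? v) ∧ (b ℕ.<ᵇ v))) ≡ stepExponent [x] (slopeAfter (partner j (slopes tail)) v) (v ℕ.<ᵇ b)
    peak-test b v tail g i i≡ v>0 b≢v g₀ g≡ with ℕP.<-cmp (length tail) j
    ... | tri< L<j _ _ = begin
      bit (does (k ℕ.≤? i) ∧ (does (g (i ∸ k) ℕ.<? v) ∧ (b ℕ.<ᵇ v)))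
        ≡⟨ cong (λ c → bit (c ∧ (does (g (i ∸ k) ℕ.<? v) ∧ (b ℕ.<ᵇ v))))
             (dec-false (k ℕ.≤? i) (λ k≤i → ℕP.<⇒≱ L<j (ℕP.≤-pred (subst (k ℕ.≤_) i≡ k≤i)))) ⟩
      0
        ≡⟨ cong (λ P → stepExponent [x] (slopeAfter P v) (v ℕ.<ᵇ b)) (sym (partner-absent j (slopes tail) (subst (ℕ._< j) (sym (length-slopes tail)) L<j))) ⟩
      stepExponent [x] (slopeAfter (partner j (slopes tail)) v) (v ℕ.<ᵇ b) ∎
      where
      open ≡-Reasoning
      k = suc j
    ... | tri≈ _ L≡j _ = begin
      bit (does (k ℕ.≤? i) ∧ (does (g (i ∸ k) ℕ.<? v) ∧ (b ℕ.<ᵇ v)))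
        ≡⟨ cong₂ (λ c t → bit (c ∧ (does (g t ℕ.<? v) ∧ (b ℕ.<ᵇ v))))
             (dec-true (k ℕ.≤? i) (ℕP.≤-reflexive (sym i≡k))) (trans (cong (_∸ k) i≡k) (ℕP.n∸n≡0 k)) ⟩
      bit (does (g 0 ℕ.<? v) ∧ (b ℕ.<ᵇ v))
        ≡⟨ cong (λ t → bit (does (t ℕ.<? v) ∧ (b ℕ.<ᵇ v))) g₀ ⟩
      bit (does (0 ℕ.<? v) ∧ (b ℕ.<ᵇ v))
        ≡⟨ cong (λ c → bit (c ∧ (b ℕ.<ᵇ v))) (dec-true (0 ℕ.<? v) v>0) ⟩
      bit (b ℕ.<ᵇ v)
        ≡⟨ cong bit (sym (<ᵇ-flip b v b≢v)) ⟩
      stepExponent [x] asc (v ℕ.<ᵇ b)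
        ≡⟨ cong (λ P → stepExponent [x] (slopeAfter P v) (v ℕ.<ᵇ b)) (sym (partner-origin j (slopes tail) (trans (length-slopes tail) L≡j))) ⟩
      stepExponent [x] (slopeAfter (partner j (slopes tail)) v) (v ℕ.<ᵇ b) ∎
      where
      open ≡-Reasoning
      k = suc j
      i≡k : i ≡ k
      i≡k = trans i≡ (cong suc L≡j)
    ... | tri> _ _ L>j = begin
      bit (does (k ℕ.≤? i) ∧ (does (g (i ∸ k) ℕ.<? v) ∧ (b ℕ.<ᵇ v)))
        ≡⟨ cong₂ (λ c t → bit (c ∧ (does (t ℕ.<? v) ∧ (b ℕ.<ᵇ v))))
             (dec-true (k ℕ.≤? i) (subst (k ℕ.≤_) (sym i≡) (s≤s (ℕP.<⇒≤ L>j)))) (g≡ L>j) ⟩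
      bit ((v′ ℕ.<ᵇ v) ∧ (b ℕ.<ᵇ v))
        ≡⟨ cong (λ c → bit ((v′ ℕ.<ᵇ v) ∧ c)) (sym (<ᵇ-flip b v b≢v)) ⟩
      bit ((v′ ℕ.<ᵇ v) ∧ not (v ℕ.<ᵇ b))
        ≡⟨ sym (stepExponent-[x]-slopeOf (v′ ℕ.<ᵇ v) (v ℕ.<ᵇ b)) ⟩
      stepExponent [x] (slopeOf (v′ ℕ.<ᵇ v)) (v ℕ.<ᵇ b)
        ≡⟨ cong (λ P → stepExponent [x] (slopeAfter P v) (v ℕ.<ᵇ b)) (sym (partner-slopes j tail L>j)) ⟩
      stepExponent [x] (slopeAfter (partner j (slopes tail)) v) (v ℕ.<ᵇ b) ∎
      where
      open ≡-Reasoning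
      k = suc j
      v′ = nth 0 j tail

    peak-entry : (b : ℕ) (r : List ℕ) → All Positive r → All (b ≢_) r → j ℕ.< length r →
      bit (isPeakAt (suc j) (length r ∸ j) b (at 0 (reverse r))) ≡ partnerExponent [x] (partner j (slopes r)) b
    peak-entry b r positive b∉r j<n = begin
      bit (does (k ℕ.≤? n ∸ j) ∧ (does (g (n ∸ j ∸ k) ℕ.<? g (n ∸ j)) ∧ does (b ℕ.<? g (n ∸ j))))
        ≡⟨ cong (λ t → bit (does (k ℕ.≤? n ∸ j) ∧ (does (g (n ∸ j ∸ k) ℕ.<? t) ∧ does (b ℕ.<? t)))) (at-reverse 0 r j (ℕP.<⇒≤ j<n)) ⟩
      bit (does (k ℕ.≤? n ∸ j) ∧ (does (g (n ∸ j ∸ k) ℕ.<? v) ∧ (b ℕ.<ᵇ v)))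
        ≡⟨ peak-test b v tail g (n ∸ j) n∸j≡ (nth-All j r positive j<n) (nth-All j r b∉r j<n) refl earlier ⟩
      stepExponent [x] (slopeAfter (partner j (slopes tail)) v) (v ℕ.<ᵇ b)
        ≡⟨ cong (λ P → partnerExponent [x] P b) (sym (partner-slopes j r j<n)) ⟩
      partnerExponent [x] (partner j (slopes r)) b ∎
      where
      open ≡-Reasoning
      k = suc j
      n = length r
      g = at 0 (reverse r)
      v = nth 0 j r
      tail = drop k r
      n∸j≡ : n ∸ j ≡ suc (length tail)
      n∸j≡ = trans (∸≡suc∸suc j n j<n) (cong suc (sym (List.length-drop k r)))
      earlier : j ℕ.< length tail → g (n ∸ j ∸ k) ≡ nth 0 j tail
      earlier j<L = trans (cong g (ℕP.∸-+-assoc n j k)) (trans (cong (λ t → g (n ∸ t)) (ℕP.+-comm j k))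
                      (trans (at-reverse 0 r (k ℕ.+ j) k+j≤n) (sym (nth-drop 0 k j r))))
        where
        k+j≤n : k ℕ.+ j ℕ.≤ n
        k+j≤n = subst (k ℕ.+ j ℕ.≤_) (ℕP.m+[n∸m]≡n j<n) (ℕP.+-monoʳ-≤ k (subst (j ℕ.≤_) (List.length-drop k r) (ℕP.<⇒≤ j<L)))

    lpeak-reverse : (r : List ℕ) → AllPairs _≢_ r → All Positive r → lpeak (length r) (suc j) (reverse r) ≡ exponent [x] r
    lpeak-reverse [] _ _ = refl
    lpeak-reverse (b ∷ r) (b∉r ∷ distinct) (_ ∷ positive) = ℤP.+-injective (begin
      + lpeak (suc n) k (reverse (b ∷ r))
        ≡⟨ cong (λ s → + lpeak (suc n) k s) (List.unfold-reverse b r) ⟩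
      + lpeak (suc n) k (reverse r ++ [ b ])
        ≡⟨ lpeak-windowSum (suc n) k _ ⟩
      windowSum 0 (suc n) k (isPeakAt k) (reverse r ++ [ b ])
        ≡⟨ windowSum-∷ʳ 0 (isPeakAt k) (isPeakAt-local k) n j (reverse r) b (List.length-reverse r) ⟩
      windowSum 0 n k (isPeakAt k) (reverse r) + new
        ≡⟨ cong (_+ new) (sym (lpeak-windowSum n k (reverse r))) ⟩
      + lpeak n k (reverse r) + new
        ≡⟨ cong₂ _+_ (cong +_ (lpeak-reverse r distinct positive)) new≡ ⟩
      + exponent [x] r + + partnerExponent [x] (partner j (slopes r)) b
        ≡⟨ trans (ℤP.+-comm (+ exponent [x] r) (+ partnerExponent [x] (partner j (slopes r)) b)) (sym (ℤP.pos-+ (partnerExponent [x] (partner j (slopes r)) b) (exponent [x] r))) ⟩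
      + exponent [x] (b ∷ r) ∎)
      where
      open ≡-Reasoning
      n = length r
      k = suc j
      new = guard (does (j ℕ.≤? n)) (guard (isPeakAt k (n ∸ j) b (at 0 (reverse r))) 1ℤ)
      new≡ : new ≡ + partnerExponent [x] (partner j (slopes r)) b
      new≡ with ℕP.<-cmp j n
      ... | tri< j<n _ _ = trans (cong (λ c → guard c (guard (isPeakAt k (n ∸ j) b (at 0 (reverse r))) 1ℤ)) (dec-true (j ℕ.≤? n) (ℕP.<⇒≤ j<n)))
                                 (trans (guard-bit _) (cong +_ (peak-entry b r positive b∉r j<n)))
      ... | tri≈ _ j≡n _ = trans (cong (λ c → guard c (guard (isPeakAt k (n ∸ j) b (at 0 (reverse r))) 1ℤ)) (dec-true (j ℕ.≤? n) (ℕP.≤-reflexive j≡n)))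
                                 (trans (cong (λ t → guard (isPeakAt k t b (at 0 (reverse r))) 1ℤ) (trans (cong (n ∸_) j≡n) (ℕP.n∸n≡0 n)))
                                        (cong (λ P → + partnerExponent [x] P b) (sym (partner-origin j (slopes r) (trans (length-slopes r) (sym j≡n))))))
      ... | tri> _ _ j>n = trans (cong (λ c → guard c (guard (isPeakAt k (n ∸ j) b (at 0 (reverse r))) 1ℤ)) (dec-false (j ℕ.≤? n) (ℕP.<⇒≱ j>n)))
                                 (cong (λ P → + partnerExponent [x] P b) (sym (partner-absent j (slopes r) (subst (ℕ._< j) (sym (length-slopes r)) j>n))))

  trues-++ : (s t : List Bool) → trues (s ++ t) ≡ trues s ℕ.+ trues t
  trues-++ [] t = refl
  trues-++ (true ∷ s) t = cong suc (trues-++ s t)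
  trues-++ (false ∷ s) t = trues-++ s t

  trues-reverse : (s : List Bool) → trues (reverse s) ≡ trues s
  trues-reverse [] = refl
  trues-reverse (e ∷ s) = begin
    trues (reverse (e ∷ s))       ≡⟨ cong trues (List.unfold-reverse e s) ⟩
    trues (reverse s ++ [ e ])    ≡⟨ trues-++ (reverse s) [ e ] ⟩
    trues (reverse s) ℕ.+ trues [ e ] ≡⟨ cong (ℕ._+ trues [ e ]) (trues-reverse s) ⟩
    trues s ℕ.+ trues [ e ]       ≡⟨ last e ⟩
    trues (e ∷ s) ∎
    where
    open ≡-Reasoning
    last : ∀ e → trues s ℕ.+ trues [ e ] ≡ trues (e ∷ s)
    last true = ℕP.+-comm (trues s) 1
    last false = ℕP.+-identityʳ (trues s)

  withSigns-∷ʳ : (s : List Bool) (u : List ℕ) (e : Bool) (b : ℕ) → length s ≡ length u →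
    withSigns (s ++ [ e ]) (u ++ [ b ]) ≡ withSigns s u ++ [ signed e b ]
  withSigns-∷ʳ [] [] e b _ = refl
  withSigns-∷ʳ (e′ ∷ s) (b′ ∷ u) e b ls = cong (signed e′ b′ ∷_) (withSigns-∷ʳ s u e b (ℕP.suc-injective ls))

  withSigns-reverse : (s : List Bool) (u : List ℕ) → length s ≡ length u →
    withSigns (reverse s) (reverse u) ≡ reverse (withSigns s u)
  withSigns-reverse [] [] _ = refl
  withSigns-reverse (e ∷ s) (b ∷ u) ls = begin
    withSigns (reverse (e ∷ s)) (reverse (b ∷ u))     ≡⟨ cong₂ withSigns (List.unfold-reverse e s) (List.unfold-reverse b u) ⟩
    withSigns (reverse s ++ [ e ]) (reverse u ++ [ b ]) ≡⟨ withSigns-∷ʳ (reverse s) (reverse u) e b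
                                                           (trans (List.length-reverse s) (trans ls′ (sym (List.length-reverse u)))) ⟩
    withSigns (reverse s) (reverse u) ++ [ signed e b ] ≡⟨ cong (_++ [ signed e b ]) (withSigns-reverse s u ls′) ⟩
    reverse (withSigns s u) ++ [ signed e b ]          ≡⟨ sym (List.unfold-reverse (signed e b) (withSigns s u)) ⟩
    reverse (withSigns (e ∷ s) (b ∷ u)) ∎
    where
    open ≡-Reasoning
    ls′ = ℕP.suc-injective ls

  signSum-reverse : (j : ℕ) (x ω : ℤ) (σ : List ℕ) →
    signSum (length σ) (suc j) x ω σ ≡ ∑ (words bools (length (reverse σ))) (Transfer.Weights.signWeight j x ω (reverse σ))
  signSum-reverse j x ω σ = begin
    signSum n k x ω σ
      ≡⟨ ∑-words-reverse bools n _ ⟩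
    ∑ (words bools n) (λ s → ω ^ trues (reverse s) * x ^ desD n k (withSigns (reverse s) σ))
      ≡⟨ ∑-words-cong bools bools-All n (λ s ls _ → reversed s ls) ⟩
    ∑ (words bools n) (signWeight (reverse σ))
      ≡⟨ cong (λ m → ∑ (words bools m) (signWeight (reverse σ))) (sym (List.length-reverse σ)) ⟩
    ∑ (words bools (length (reverse σ))) (signWeight (reverse σ)) ∎
    where
    open ≡-Reasoning
    open Transfer.Weights j x ω using (signWeight)
    n = length σ
    k = suc j
    reversed : ∀ s → length s ≡ n → ω ^ trues (reverse s) * x ^ desD n k (withSigns (reverse s) σ) ≡ signWeight (reverse σ) s
    reversed s ls = begin
      ω ^ trues (reverse s) * x ^ desD n k (withSigns (reverse s) σ)
        ≡⟨ cong₂ (λ a u → ω ^ a * x ^ desD n k (withSigns (reverse s) u)) (trues-reverse s) (sym (List.reverse-involutive σ)) ⟩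
      ω ^ trues s * x ^ desD n k (withSigns (reverse s) (reverse (reverse σ)))
        ≡⟨ cong (λ w → ω ^ trues s * x ^ desD n k w) (withSigns-reverse s (reverse σ) ls′) ⟩
      ω ^ trues s * x ^ desD n k (reverse (withSigns s (reverse σ)))
        ≡⟨ cong (λ m → ω ^ trues s * x ^ desD m k (reverse (withSigns s (reverse σ)))) n≡ ⟩
      ω ^ trues s * x ^ desD (length (withSigns s (reverse σ))) k (reverse (withSigns s (reverse σ)))
        ≡⟨ cong (λ d → ω ^ trues s * x ^ d) (desD-reverse j (withSigns s (reverse σ))) ⟩
      signWeight (reverse σ) s ∎
      where
      ls′ : length s ≡ length (reverse σ)
      ls′ = trans ls (sym (List.length-reverse σ))
      n≡ : n ≡ length (withSigns s (reverse σ))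
      n≡ = sym (trans (length-withSigns s (reverse σ) ls′) (List.length-reverse σ))

  module Evaluation (j : ℕ) (x : ℤ) where
    open Transfer j

    monomial-at-one : (r : List ℕ) → j ℕ.≤ length r →
      Weights.monomial x 1ℤ (totalExponent r) ≡ (+ 2) ^ (2 ℕ.* peaks r ℕ.+ j) * x ^ peaks r * (1ℤ + x) ^ (length r ∸ j ∸ 2 ℕ.* peaks r)
    monomial-at-one r j≤r = begin
      (1ℤ + 1ℤ) ^ a * x ^ q * (1ℤ + 1ℤ * x) ^ E₁ * (x + 1ℤ) ^ E₂
        ≡⟨ cong₂ (λ a q → (+ 2) ^ a * x ^ q * (1ℤ + 1ℤ * x) ^ E₁ * (x + 1ℤ) ^ E₂) (totalExponent-[1+ω] r j≤r) (totalExponent-[x] r) ⟩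
      (+ 2) ^ (2 ℕ.* peaks r ℕ.+ j) * x ^ peaks r * (1ℤ + 1ℤ * x) ^ E₁ * (x + 1ℤ) ^ E₂
        ≡⟨ cong₂ (λ a b → (+ 2) ^ (2 ℕ.* peaks r ℕ.+ j) * x ^ peaks r * a ^ E₁ * b ^ E₂) (cong (_+_ 1ℤ) (ℤP.*-identityˡ x)) (ℤP.+-comm x 1ℤ) ⟩
      (+ 2) ^ (2 ℕ.* peaks r ℕ.+ j) * x ^ peaks r * (1ℤ + x) ^ E₁ * (1ℤ + x) ^ E₂
        ≡⟨ ℤP.*-assoc ((+ 2) ^ (2 ℕ.* peaks r ℕ.+ j) * x ^ peaks r) _ _ ⟩
      (+ 2) ^ (2 ℕ.* peaks r ℕ.+ j) * x ^ peaks r * ((1ℤ + x) ^ E₁ * (1ℤ + x) ^ E₂)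
        ≡⟨ cong ((+ 2) ^ (2 ℕ.* peaks r ℕ.+ j) * x ^ peaks r *_) (sym (ℤP.^-distribˡ-+-* (1ℤ + x) E₁ E₂)) ⟩
      (+ 2) ^ (2 ℕ.* peaks r ℕ.+ j) * x ^ peaks r * (1ℤ + x) ^ (E₁ ℕ.+ E₂)
        ≡⟨ cong (λ e → (+ 2) ^ (2 ℕ.* peaks r ℕ.+ j) * x ^ peaks r * (1ℤ + x) ^ e) (totalExponent-rest r j≤r) ⟩
      (+ 2) ^ (2 ℕ.* peaks r ℕ.+ j) * x ^ peaks r * (1ℤ + x) ^ (length r ∸ j ∸ 2 ℕ.* peaks r) ∎
      where
      open ≡-Reasoning
      a = totalExponent r [1+ω]
      q = totalExponent r [x]
      E₁ = totalExponent r [1+ωx]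
      E₂ = totalExponent r [x+ω]

    monomial-at-minus-one : (r : List ℕ) → j ℕ.≤ length r → 1 ℕ.≤ j → Weights.monomial x (- 1ℤ) (totalExponent r) ≡ 0ℤ
    monomial-at-minus-one r j≤r (s≤s z≤n) =
      cong (λ a → 0ℤ ^ a * x ^ totalExponent r [x] * (1ℤ + - 1ℤ * x) ^ totalExponent r [1+ωx] * (x + - 1ℤ) ^ totalExponent r [x+ω])
           (trans (totalExponent-[1+ω] r j≤r) (ℕP.+-suc (2 ℕ.* peaks r) _))

  signSum-monomial : (j : ℕ) (x ω : ℤ) (σ : List ℕ) → AllPairs _≢_ σ → All Positive σ →
    signSum (length σ) (suc j) x ω σ ≡ Transfer.Weights.monomial j x ω (Transfer.totalExponent j (reverse σ))
  signSum-monomial j x ω σ distinct positive =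
    trans (signSum-reverse j x ω σ) (Transfer.Weights.∑-signWeight j x ω (reverse σ) (AllPairs-reverse σ distinct) (All-reverse σ positive))

  peaks-reverse : (j : ℕ) (σ : List ℕ) → AllPairs _≢_ σ → All Positive σ → Transfer.peaks j (reverse σ) ≡ lpeak (length σ) (suc j) σ
  peaks-reverse j σ distinct positive = sym (begin
    lpeak (length σ) (suc j) σ
      ≡⟨ cong₂ (λ n s → lpeak n (suc j) s) (sym (List.length-reverse σ)) (sym (List.reverse-involutive σ)) ⟩
    lpeak (length (reverse σ)) (suc j) (reverse (reverse σ))
      ≡⟨ Peaks.lpeak-reverse j (reverse σ) (AllPairs-reverse σ distinct) (All-reverse σ positive) ⟩
    Transfer.peaks j (reverse σ) ∎)
    where open ≡-Reasoning

  pos-^ : (a e : ℕ) → (+ a) ^ e ≡ + (a ℕ.^ e)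
  pos-^ a zero = refl
  pos-^ a (suc e) = trans (cong (+ a *_) (pos-^ a e)) (sym (ℤP.pos-* a (a ℕ.^ e)))

  gammaTerm : ℕ → ℤ → ℕ → ℤ → ℤ
  gammaTerm m c p x = c * x ^ p * (1ℤ + x) ^ (m ∸ 2 ℕ.* p)

  evenSignSum-lpeak : (j : ℕ) (x : ℤ) (σ : List ℕ) → AllPairs _≢_ σ → All Positive σ → suc j ℕ.≤ length σ →
    let p = lpeak (length σ) (suc (suc j)) σ in
    evenSignSum (length σ) (suc (suc j)) x σ ≡ gammaTerm (length σ ∸ suc j) (+ (2 ℕ.^ (2 ℕ.* p ℕ.+ j))) p x
  evenSignSum-lpeak j x σ distinct positive j<n = ℤP.*-cancelʳ-≡ _ _ (+ 2) (begin
    evenSignSum n k x σ * + 2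
      ≡⟨ evenSignSum-*2 n k x σ positive refl ⟩
    signSum n k x 1ℤ σ + signSum n k x (- 1ℤ) σ
      ≡⟨ cong₂ _+_ (signSum-monomial (suc j) x 1ℤ σ distinct positive) (signSum-monomial (suc j) x (- 1ℤ) σ distinct positive) ⟩
    Weights.monomial x 1ℤ (totalExponent r) + Weights.monomial x (- 1ℤ) (totalExponent r)
      ≡⟨ cong₂ _+_ (Evaluation.monomial-at-one (suc j) x r j<r) (Evaluation.monomial-at-minus-one (suc j) x r j<r (s≤s z≤n)) ⟩
    (+ 2) ^ (2 ℕ.* P ℕ.+ suc j) * x ^ P * (1ℤ + x) ^ (length r ∸ suc j ∸ 2 ℕ.* P) + 0ℤ
      ≡⟨ ℤP.+-identityʳ _ ⟩
    (+ 2) ^ (2 ℕ.* P ℕ.+ suc j) * x ^ P * (1ℤ + x) ^ (length r ∸ suc j ∸ 2 ℕ.* P)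
      ≡⟨ cong₂ (λ q m → (+ 2) ^ (2 ℕ.* q ℕ.+ suc j) * x ^ q * (1ℤ + x) ^ (m ∸ suc j ∸ 2 ℕ.* q))
           (peaks-reverse (suc j) σ distinct positive) (List.length-reverse σ) ⟩
    (+ 2) ^ (2 ℕ.* p ℕ.+ suc j) * x ^ p * (1ℤ + x) ^ (n ∸ suc j ∸ 2 ℕ.* p)
      ≡⟨ cong (λ a → a * x ^ p * (1ℤ + x) ^ (n ∸ suc j ∸ 2 ℕ.* p))
           (trans (cong ((+ 2) ^_) (ℕP.+-suc (2 ℕ.* p) j)) (cong (+ 2 *_) (pos-^ 2 (2 ℕ.* p ℕ.+ j)))) ⟩
    + 2 * + (2 ℕ.^ (2 ℕ.* p ℕ.+ j)) * x ^ p * (1ℤ + x) ^ (n ∸ suc j ∸ 2 ℕ.* p)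
      ≡⟨ double (+ (2 ℕ.^ (2 ℕ.* p ℕ.+ j))) (x ^ p) ((1ℤ + x) ^ (n ∸ suc j ∸ 2 ℕ.* p)) ⟩
    gammaTerm (n ∸ suc j) (+ (2 ℕ.^ (2 ℕ.* p ℕ.+ j))) p x * + 2 ∎)
    where
    open ≡-Reasoning
    open Transfer (suc j) using (module Weights; totalExponent)
    n = length σ
    k = suc (suc j)
    r = reverse σ
    p = lpeak n k σ
    P = Transfer.peaks (suc j) r
    j<r : suc j ℕ.≤ length r
    j<r = subst (suc j ℕ.≤_) (sym (List.length-reverse σ)) j<n
    double : ∀ a b c → + 2 * a * b * c ≡ a * b * c * + 2
    double = solve-∀

  ≤-half : (p m : ℕ) → 2 ℕ.* p ℕ.≤ m → p ℕ.≤ m / 2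
  ≤-half p m 2p≤m = subst (ℕ._≤ m / 2) (trans (cong (_/ 2) (ℕP.*-comm 2 p)) (ℕ.m*n/n≡m p 2)) (ℕ./-monoˡ-≤ 2 2p≤m)

  lpeak-bound : (j : ℕ) (σ : List ℕ) → AllPairs _≢_ σ → All Positive σ → j ℕ.≤ length σ →
    lpeak (length σ) (suc j) σ ℕ.< suc ((length σ ∸ j) / 2)
  lpeak-bound j σ distinct positive j≤n = s≤s (≤-half _ _
    (subst₂ (λ p m → 2 ℕ.* p ℕ.≤ m ∸ j) (peaks-reverse j σ distinct positive) (List.length-reverse σ)
      (Transfer.peaks-bound j (reverse σ) (subst (j ℕ.≤_) (sym (List.length-reverse σ)) j≤n))))

  ∑-permutations-cong : (n : ℕ) {f g : List ℕ → ℤ} →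
    (∀ u → length u ≡ n → All Positive u → AllPairs _≢_ u → f u ≡ g u) →
    ∑ (words (positives n) n) (λ u → guard (does (unique? u)) (f u)) ≡ ∑ (words (positives n) n) (λ u → guard (does (unique? u)) (g u))
  ∑-permutations-cong n f≡g = ∑-words-cong (positives n) (positives-All n) n (λ u lu pu → guard-cong (unique? u) (f≡g u lu pu))

  GammaCard-∑ : (n k p : ℕ) (c : ℤ) →
    + GammaCard n k p * c ≡ ∑ (words (positives n) n) (λ u → guard (does (unique? u)) (guard (does (lpeak n k u ℕ.≟ p)) c))
  GammaCard-∑ n k p c = begin
    + GammaCard n k p * c
      ≡⟨ cong (_* c) (trans (length-filter-∑ (λ s → lpeak n k s ℕ.≟ p) (Sn n)) (∑-filter unique? (words (positives n) n) _)) ⟩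
    ∑ (words (positives n) n) (λ u → guard (does (unique? u)) (guard (does (lpeak n k u ℕ.≟ p)) 1ℤ)) * c
      ≡⟨ trans (ℤP.*-comm _ c) (∑-*ˡ c (words (positives n) n) _) ⟩
    ∑ (words (positives n) n) (λ u → c * guard (does (unique? u)) (guard (does (lpeak n k u ℕ.≟ p)) 1ℤ))
      ≡⟨ ∑-cong (words (positives n) n) (λ u → trans (ℤP.*-comm c _)
           (trans (guard-*ʳ (does (unique? u)) _ c) (cong (guard (does (unique? u))) (trans (guard-*ʳ (does (lpeak n k u ℕ.≟ p)) 1ℤ c)
             (cong (guard (does (lpeak n k u ℕ.≟ p))) (ℤP.*-identityˡ c)))))) ⟩
    ∑ (words (positives n) n) (λ u → guard (does (unique? u)) (guard (does (lpeak n k u ℕ.≟ p)) c)) ∎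
    where open ≡-Reasoning

  ∑-by-statistic : (n M : ℕ) (stat : List ℕ → ℕ) (F : ℕ → ℤ) →
    (∀ u → length u ≡ n → All Positive u → AllPairs _≢_ u → stat u ℕ.< M) →
    ∑ (words (positives n) n) (λ u → guard (does (unique? u)) (F (stat u))) ≡
    ∑ (upTo M) (λ q → ∑ (words (positives n) n) (λ u → guard (does (unique? u)) (guard (does (stat u ℕ.≟ q)) (F q))))
  ∑-by-statistic n M stat F bound = begin
    ∑ W (λ u → guard (does (unique? u)) (F (stat u)))
      ≡⟨ ∑-permutations-cong n (λ u lu pu du → sym (∑-upTo-δ M (stat u) F (bound u lu pu du))) ⟩
    ∑ W (λ u → guard (does (unique? u)) (∑ (upTo M) (λ q → guard (does (stat u ℕ.≟ q)) (F q))))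
      ≡⟨ ∑-cong W (λ u → sym (∑-guard (does (unique? u)) (upTo M) _)) ⟩
    ∑ W (λ u → ∑ (upTo M) (λ q → guard (does (unique? u)) (guard (does (stat u ℕ.≟ q)) (F q))))
      ≡⟨ ∑-swap W (upTo M) _ ⟩
    ∑ (upTo M) (λ q → ∑ W (λ u → guard (does (unique? u)) (guard (does (stat u ℕ.≟ q)) (F q)))) ∎
    where
    open ≡-Reasoning
    W = words (positives n) n

  module Step≥2 (j : ℕ) where

    k : ℕ
    k = suc (suc j)

    γ : ℕ → ℕ → ℤ
    γ n p = + (2 ℕ.^ (2 ℕ.* p ℕ.+ j) ℕ.* GammaCard n k p)

    WD-gammaExpansion : (n : ℕ) → k ℕ.≤ n → (x : ℤ) → WD n k x ≡ gammaExpansion n k (γ n) x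
    WD-gammaExpansion n k≤n x = begin
      WD n k x
        ≡⟨ WD-∑-unsigned n k x ⟩
      ∑ W (λ u → guard (does (unique? u)) (evenSignSum n k x u))
        ≡⟨ ∑-permutations-cong n (λ { u refl pu du → evenSignSum-lpeak j x u du pu (ℕP.<⇒≤ k≤n) }) ⟩
      ∑ W (λ u → guard (does (unique? u)) (T (lpeak n k u)))
        ≡⟨ ∑-by-statistic n (suc (m / 2)) (lpeak n k) T (λ { u refl pu du → lpeak-bound (suc j) u du pu (ℕP.<⇒≤ k≤n) }) ⟩
      ∑ (upTo (suc (m / 2))) (λ q → ∑ W (λ u → guard (does (unique? u)) (guard (does (lpeak n k u ℕ.≟ q)) (T q))))
        ≡⟨ ∑-cong (upTo (suc (m / 2))) (λ q → sym (trans (coefficient q) (GammaCard-∑ n k q (T q)))) ⟩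
      gammaExpansion n k (γ n) x ∎
      where
      open ≡-Reasoning
      W = words (positives n) n
      m = n ∸ suc j
      T : ℕ → ℤ
      T p = gammaTerm m (+ (2 ℕ.^ (2 ℕ.* p ℕ.+ j))) p x
      coefficient : ∀ q → gammaTerm m (γ n q) q x ≡ + GammaCard n k q * T q
      coefficient q = trans (cong (λ c → c * x ^ q * (1ℤ + x) ^ (m ∸ 2 ℕ.* q)) (ℤP.pos-* (2 ℕ.^ (2 ℕ.* q ℕ.+ j)) _))
                            (reassoc (+ (2 ℕ.^ (2 ℕ.* q ℕ.+ j))) (+ GammaCard n k q) (x ^ q) ((1ℤ + x) ^ (m ∸ 2 ℕ.* q)))
        where
        reassoc : ∀ a g b c → a * g * b * c ≡ g * (a * b * c)
        reassoc = solve-∀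

  -- The coefficients of (1 - x)^{2h} = ((1 + x)^2 - 4x)^h in the basis x^q (1 + x)^{2h-2q}:
  -- c (h + 1) q = c h q - 4 c h (q - 1), so every coefficient except c h 0 = 1 is even.
  mutual
    oneMinusCoeff : ℕ → ℕ → ℤ
    oneMinusCoeff h zero = 1ℤ
    oneMinusCoeff h (suc q) = + 2 * oneMinusHalf h q

    oneMinusHalf : ℕ → ℕ → ℤ
    oneMinusHalf zero q = 0ℤ
    oneMinusHalf (suc h) q = oneMinusHalf h q - + 2 * oneMinusCoeff h q

  oneMinusHalf-vanishes : (h q : ℕ) → h ℕ.≤ q → oneMinusHalf h q ≡ 0ℤ
  oneMinusHalf-vanishes zero q _ = refl
  oneMinusHalf-vanishes (suc h) (suc q) (s≤s h≤q)
    rewrite oneMinusHalf-vanishes h (suc q) (ℕP.m≤n⇒m≤1+n h≤q) | oneMinusHalf-vanishes h q h≤q = refl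

  shift : (ℕ → ℤ) → ℕ → ℤ
  shift f zero = 0ℤ
  shift f (suc q) = f q

  oneMinusCoeff-suc : (h q : ℕ) → oneMinusCoeff h q + - + 4 * shift (oneMinusCoeff h) q ≡ oneMinusCoeff (suc h) q
  oneMinusCoeff-suc h zero = refl
  oneMinusCoeff-suc h (suc q) = factor-two (oneMinusHalf h q) (oneMinusCoeff h q)
    where
    factor-two : ∀ u t → + 2 * u + - + 4 * t ≡ + 2 * (u - + 2 * t)
    factor-two = solve-∀

  module GammaBasis (x : ℤ) where

    gammaSum : ℕ → (ℕ → ℤ) → ℤ
    gammaSum h f = ∑ (upTo (suc h)) (λ q → gammaTerm (2 ℕ.* h) (f q) q x)

    gammaSum-+ : (h : ℕ) (f g : ℕ → ℤ) → gammaSum h f + gammaSum h g ≡ gammaSum h (λ q → f q + g q)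
    gammaSum-+ h f g = trans (sym (∑-+ (upTo (suc h)) (λ q → gammaTerm (2 ℕ.* h) (f q) q x) (λ q → gammaTerm (2 ℕ.* h) (g q) q x))) (∑-cong (upTo (suc h)) (λ q → distrib (f q) (g q) (x ^ q) _))
      where
      distrib : ∀ a b X Y → a * X * Y + b * X * Y ≡ (a + b) * X * Y
      distrib = solve-∀

    gammaSum-*ˡ : (h : ℕ) (c : ℤ) (f : ℕ → ℤ) → c * gammaSum h f ≡ gammaSum h (λ q → c * f q)
    gammaSum-*ˡ h c f = trans (∑-*ˡ c (upTo (suc h)) (λ q → gammaTerm (2 ℕ.* h) (f q) q x)) (∑-cong (upTo (suc h)) (λ q → assoc c (f q) (x ^ q) _))
      where
      assoc : ∀ c a X Y → c * (a * X * Y) ≡ c * a * X * Y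
      assoc = solve-∀

    gammaSum-δ : (h P : ℕ) (f : ℕ → ℤ) → P ℕ.< suc h →
      gammaSum h (λ q → guard (does (P ℕ.≟ q)) (f q)) ≡ gammaTerm (2 ℕ.* h) (f P) P x
    gammaSum-δ h P f P≤h = trans (∑-cong (upTo (suc h)) (λ q → trans (cong (_* (1ℤ + x) ^ (2 ℕ.* h ∸ 2 ℕ.* q)) (guard-*ʳ (does (P ℕ.≟ q)) (f q) (x ^ q)))
                                                                      (guard-*ʳ (does (P ℕ.≟ q)) (f q * x ^ q) _)))
                                 (∑-upTo-δ (suc h) P (λ q → gammaTerm (2 ℕ.* h) (f q) q x) P≤h)

    ∑-gammaSum : (W : List (List ℕ)) (d : List ℕ → ℕ → ℤ) (h : ℕ) →
      ∑ W (λ u → gammaSum h (d u)) ≡ gammaSum h (λ q → ∑ W (λ u → d u q))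
    ∑-gammaSum W d h = trans (∑-swap W (upTo (suc h)) (λ u q → gammaTerm (2 ℕ.* h) (d u q) q x)) (∑-cong (upTo (suc h)) (λ q → collect q))
      where
      collect : ∀ q → ∑ W (λ u → d u q * x ^ q * (1ℤ + x) ^ (2 ℕ.* h ∸ 2 ℕ.* q)) ≡ ∑ W (λ u → d u q) * x ^ q * (1ℤ + x) ^ (2 ℕ.* h ∸ 2 ℕ.* q)
      collect q = begin
        ∑ W (λ u → d u q * X * Y)   ≡⟨ ∑-cong W (λ u → reassoc (d u q) X Y) ⟩
        ∑ W (λ u → X * Y * d u q)   ≡⟨ sym (∑-*ˡ (X * Y) W (λ u → d u q)) ⟩
        X * Y * ∑ W (λ u → d u q)   ≡⟨ sym (reassoc (∑ W (λ u → d u q)) X Y) ⟩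
        ∑ W (λ u → d u q) * X * Y   ∎
        where
        open ≡-Reasoning
        X = x ^ q
        Y = (1ℤ + x) ^ (2 ℕ.* h ∸ 2 ℕ.* q)
        reassoc : ∀ a X Y → a * X * Y ≡ X * Y * a
        reassoc = solve-∀

    gammaSum-square : (h : ℕ) (f : ℕ → ℤ) → f (suc h) ≡ 0ℤ → (1ℤ + x) * (1ℤ + x) * gammaSum h f ≡ gammaSum (suc h) f
    gammaSum-square h f f-top = begin
      (1ℤ + x) * (1ℤ + x) * gammaSum h f
        ≡⟨ ∑-*ˡ ((1ℤ + x) * (1ℤ + x)) (upTo (suc h)) _ ⟩
      ∑ (upTo (suc h)) (λ q → (1ℤ + x) * (1ℤ + x) * gammaTerm (2 ℕ.* h) (f q) q x)
        ≡⟨ ∑-cong-All (All.map (λ {q} → raise q) (All.all-upTo (suc h))) ⟩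
      ∑ (upTo (suc h)) (λ q → gammaTerm (2 ℕ.* suc h) (f q) q x)
        ≡⟨ sym (trans (∑-upTo-∷ʳ (suc h) (λ q → gammaTerm (2 ℕ.* suc h) (f q) q x)) (trans (cong (λ c → ∑ (upTo (suc h)) (λ q → gammaTerm (2 ℕ.* suc h) (f q) q x) + gammaTerm (2 ℕ.* suc h) c (suc h) x) f-top)
                                                   (ℤP.+-identityʳ _))) ⟩
      gammaSum (suc h) f ∎
      where
      open ≡-Reasoning
      raise : ∀ q → q ℕ.< suc h → (1ℤ + x) * (1ℤ + x) * gammaTerm (2 ℕ.* h) (f q) q x ≡ gammaTerm (2 ℕ.* suc h) (f q) q x
      raise q q<1+h = trans (reassoc (1ℤ + x) (f q) (x ^ q) ((1ℤ + x) ^ (2 ℕ.* h ∸ 2 ℕ.* q)))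
        (cong (λ e → f q * x ^ q * (1ℤ + x) ^ e)
              (sym (trans (cong (_∸ 2 ℕ.* q) (ℕP.*-suc 2 h)) (ℕP.+-∸-assoc 2 (ℕP.*-monoʳ-≤ 2 (ℕP.≤-pred q<1+h))))))
        where
        reassoc : ∀ y a b c → y * y * (a * b * c) ≡ a * b * (y * (y * c))
        reassoc = solve-∀

    gammaSum-x : (h : ℕ) (f : ℕ → ℤ) → x * gammaSum h f ≡ gammaSum (suc h) (shift f)
    gammaSum-x h f = begin
      x * gammaSum h f
        ≡⟨ ∑-*ˡ x (upTo (suc h)) _ ⟩
      ∑ (upTo (suc h)) (λ q → x * gammaTerm (2 ℕ.* h) (f q) q x)
        ≡⟨ ∑-cong (upTo (suc h)) (λ q → trans (reassoc x (f q) (x ^ q) _) (cong (λ e → f q * x ^ suc q * (1ℤ + x) ^ e) (sym (cong₂ _∸_ (ℕP.*-suc 2 h) (ℕP.*-suc 2 q))))) ⟩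
      ∑ (upTo (suc h)) (λ q → gammaTerm (2 ℕ.* suc h) (shift f (suc q)) (suc q) x)
        ≡⟨ sym (trans (∑-upTo-suc (suc h) (λ q → gammaTerm (2 ℕ.* suc h) (shift f q) q x)) (ℤP.+-identityˡ _)) ⟩
      gammaSum (suc h) (shift f) ∎
      where
      open ≡-Reasoning
      reassoc : ∀ x a b c → x * (a * b * c) ≡ a * (x * b) * c
      reassoc = solve-∀

    oneMinus-gammaSum : (h : ℕ) → (1ℤ - x) ^ (2 ℕ.* h) ≡ gammaSum h (oneMinusCoeff h)
    oneMinus-gammaSum zero = refl
    oneMinus-gammaSum (suc h) = begin
      (1ℤ - x) ^ (2 ℕ.* suc h)
        ≡⟨ cong ((1ℤ - x) ^_) (ℕP.*-suc 2 h) ⟩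
      (1ℤ - x) * ((1ℤ - x) * (1ℤ - x) ^ (2 ℕ.* h))
        ≡⟨ cong (λ t → (1ℤ - x) * ((1ℤ - x) * t)) (oneMinus-gammaSum h) ⟩
      (1ℤ - x) * ((1ℤ - x) * S)
        ≡⟨ square-minus-four x S ⟩
      (1ℤ + x) * (1ℤ + x) * S + - + 4 * (x * S)
        ≡⟨ cong₂ (λ a b → a + - + 4 * b) (gammaSum-square h c top) (gammaSum-x h c) ⟩
      gammaSum (suc h) c + - + 4 * gammaSum (suc h) (shift c)
        ≡⟨ cong (_+_ (gammaSum (suc h) c)) (gammaSum-*ˡ (suc h) (- + 4) (shift c)) ⟩
      gammaSum (suc h) c + gammaSum (suc h) (λ q → - + 4 * shift c q)
        ≡⟨ gammaSum-+ (suc h) c (λ q → - + 4 * shift c q) ⟩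
      gammaSum (suc h) (λ q → c q + - + 4 * shift c q)
        ≡⟨ ∑-cong (upTo (suc (suc h))) (λ q → cong (λ a → gammaTerm (2 ℕ.* suc h) a q x) (oneMinusCoeff-suc h q)) ⟩
      gammaSum (suc h) (oneMinusCoeff (suc h)) ∎
      where
      open ≡-Reasoning
      c = oneMinusCoeff h
      S = gammaSum h c
      top : c (suc h) ≡ 0ℤ
      top = cong (+ 2 *_) (oneMinusHalf-vanishes h h ℕP.≤-refl)
      square-minus-four : ∀ x S → (1ℤ - x) * ((1ℤ - x) * S) ≡ (1ℤ + x) * (1ℤ + x) * S + - + 4 * (x * S)
      square-minus-four = solve-∀

  peaklessSign : ℕ → ℕ → ℤ
  peaklessSign zero e = (- 1ℤ) ^ e
  peaklessSign (suc _) e = 0ℤ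

  halfParity : ℕ → ℤ
  halfParity zero = 1ℤ
  halfParity (suc zero) = 0ℤ
  halfParity (suc (suc e)) = halfParity e

  halfParity-*2 : (e : ℕ) → halfParity e * + 2 ≡ 1ℤ + (- 1ℤ) ^ e * 1ℤ
  halfParity-*2 zero = refl
  halfParity-*2 (suc zero) = refl
  halfParity-*2 (suc (suc e)) = trans (halfParity-*2 e) (sign² ((- 1ℤ) ^ e))
    where
    sign² : ∀ a → 1ℤ + a * 1ℤ ≡ 1ℤ + - 1ℤ * (- 1ℤ * a) * 1ℤ
    sign² = solve-∀

  evenCoefficient : ℕ → ℕ → ℕ → ℕ → ℤ
  evenCoefficient h P e (suc q) = guard (does (P ℕ.≟ suc q)) (+ (2 ℕ.^ suc (2 ℕ.* q))) + peaklessSign P e * oneMinusHalf h q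
  evenCoefficient h zero e zero = halfParity e
  evenCoefficient h (suc _) e zero = 0ℤ

  evenCoefficient-*2 : (h P e q : ℕ) →
    evenCoefficient h P e q * + 2 ≡ guard (does (P ℕ.≟ q)) (+ (2 ℕ.^ (2 ℕ.* q))) + peaklessSign P e * oneMinusCoeff h q
  evenCoefficient-*2 h zero e zero = halfParity-*2 e
  evenCoefficient-*2 h (suc P) e zero = refl
  evenCoefficient-*2 h P e (suc q) = trans (ℤP.*-distribʳ-+ (+ 2) (guard (does (P ℕ.≟ suc q)) (+ (2 ℕ.^ suc (2 ℕ.* q)))) (peaklessSign P e * oneMinusHalf h q))
    (cong₂ _+_ (trans (guard-*ʳ (does (P ℕ.≟ suc q)) (+ (2 ℕ.^ suc (2 ℕ.* q))) (+ 2)) (cong (guard (does (P ℕ.≟ suc q))) power))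
               (reassoc (peaklessSign P e) (oneMinusHalf h q)))
    where
    power : + (2 ℕ.^ suc (2 ℕ.* q)) * + 2 ≡ + (2 ℕ.^ (2 ℕ.* suc q))
    power = trans (sym (ℤP.pos-* (2 ℕ.^ suc (2 ℕ.* q)) 2))
                  (cong +_ (trans (ℕP.*-comm (2 ℕ.^ suc (2 ℕ.* q)) 2) (cong (2 ℕ.^_) (sym (ℕP.*-suc 2 q)))))
    reassoc : ∀ c u → c * u * + 2 ≡ c * (+ 2 * u)
    reassoc = solve-∀

  flip-power : (x : ℤ) (e : ℕ) → (x + - 1ℤ) ^ e ≡ (- 1ℤ) ^ e * (1ℤ - x) ^ e
  flip-power x zero = refl
  flip-power x (suc e) = trans (cong ((x + - 1ℤ) *_) (flip-power x e)) (step x ((- 1ℤ) ^ e) ((1ℤ - x) ^ e))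
    where
    step : ∀ x a b → (x + - 1ℤ) * (a * b) ≡ - 1ℤ * a * ((1ℤ - x) * b)
    step = solve-∀

  powers-at-minus-one : (x : ℤ) (a p E₁ E₂ n : ℕ) → a ≡ 2 ℕ.* p ℕ.+ 0 → E₁ ℕ.+ E₂ ≡ n ∸ 0 ∸ 2 ℕ.* p →
    (1ℤ + - 1ℤ) ^ a * x ^ p * (1ℤ + - 1ℤ * x) ^ E₁ * (x + - 1ℤ) ^ E₂ ≡ peaklessSign p E₂ * (1ℤ - x) ^ n
  powers-at-minus-one x a (suc p) E₁ E₂ n refl _ = refl
  powers-at-minus-one x a zero E₁ E₂ n refl E₁+E₂≡n = begin
    1ℤ * 1ℤ * (1ℤ + - 1ℤ * x) ^ E₁ * (x + - 1ℤ) ^ E₂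
      ≡⟨ cong₂ (λ a b → 1ℤ * 1ℤ * a ^ E₁ * b) (negate x) (flip-power x E₂) ⟩
    1ℤ * 1ℤ * (1ℤ - x) ^ E₁ * ((- 1ℤ) ^ E₂ * (1ℤ - x) ^ E₂)
      ≡⟨ reassoc ((1ℤ - x) ^ E₁) ((- 1ℤ) ^ E₂) ((1ℤ - x) ^ E₂) ⟩
    (- 1ℤ) ^ E₂ * ((1ℤ - x) ^ E₁ * (1ℤ - x) ^ E₂)
      ≡⟨ cong ((- 1ℤ) ^ E₂ *_) (trans (sym (ℤP.^-distribˡ-+-* (1ℤ - x) E₁ E₂)) (cong ((1ℤ - x) ^_) E₁+E₂≡n)) ⟩
    (- 1ℤ) ^ E₂ * (1ℤ - x) ^ n ∎
    where
    open ≡-Reasoning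
    negate : ∀ x → 1ℤ + - 1ℤ * x ≡ 1ℤ - x
    negate = solve-∀
    reassoc : ∀ a b c → 1ℤ * 1ℤ * a * (b * c) ≡ b * (a * c)
    reassoc = solve-∀

  monomial-at-minus-one₀ : (x : ℤ) (r : List ℕ) →
    Transfer.Weights.monomial 0 x (- 1ℤ) (Transfer.totalExponent 0 r)
    ≡ peaklessSign (Transfer.peaks 0 r) (Transfer.totalExponent 0 r [x+ω]) * (1ℤ - x) ^ length r
  monomial-at-minus-one₀ x r =
    trans (cong (λ q → (1ℤ + - 1ℤ) ^ totalExponent r [1+ω] * x ^ q * (1ℤ + - 1ℤ * x) ^ totalExponent r [1+ωx] * (x + - 1ℤ) ^ totalExponent r [x+ω])
                (totalExponent-[x] r))
          (powers-at-minus-one x (totalExponent r [1+ω]) (peaks r) (totalExponent r [1+ωx]) (totalExponent r [x+ω]) (length r) (totalExponent-[1+ω] r z≤n) (totalExponent-rest r z≤n))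
    where open Transfer 0

  module Step1 (h : ℕ) where

    n : ℕ
    n = 2 ℕ.* h

    coefficient : List ℕ → ℕ → ℤ
    coefficient σ = evenCoefficient h (Transfer.peaks 0 (reverse σ)) (Transfer.totalExponent 0 (reverse σ) [x+ω])

    evenSignSum-gammaSum : (x : ℤ) (σ : List ℕ) → AllPairs _≢_ σ → All Positive σ → length σ ≡ n →
      evenSignSum n 1 x σ ≡ GammaBasis.gammaSum x h (coefficient σ)
    evenSignSum-gammaSum x σ distinct positive lσ = ℤP.*-cancelʳ-≡ _ _ (+ 2) (begin
      evenSignSum n 1 x σ * + 2
        ≡⟨ evenSignSum-*2 n 1 x σ positive lσ ⟩
      signSum n 1 x 1ℤ σ + signSum n 1 x (- 1ℤ) σ
        ≡⟨ cong (λ m → signSum m 1 x 1ℤ σ + signSum m 1 x (- 1ℤ) σ) (sym lσ) ⟩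
      signSum (length σ) 1 x 1ℤ σ + signSum (length σ) 1 x (- 1ℤ) σ
        ≡⟨ cong₂ _+_ (signSum-monomial 0 x 1ℤ σ distinct positive) (signSum-monomial 0 x (- 1ℤ) σ distinct positive) ⟩
      Weights.monomial x 1ℤ (totalExponent r) + Weights.monomial x (- 1ℤ) (totalExponent r)
        ≡⟨ cong₂ _+_ (Evaluation.monomial-at-one 0 x r z≤n) (monomial-at-minus-one₀ x r) ⟩
      (+ 2) ^ (2 ℕ.* P ℕ.+ 0) * x ^ P * (1ℤ + x) ^ (length r ∸ 0 ∸ 2 ℕ.* P) + peaklessSign P e * (1ℤ - x) ^ length r
        ≡⟨ cong₂ (λ a m → a * x ^ P * (1ℤ + x) ^ (m ∸ 2 ℕ.* P) + peaklessSign P e * (1ℤ - x) ^ m)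
             (trans (cong ((+ 2) ^_) (ℕP.+-identityʳ (2 ℕ.* P))) (pos-^ 2 (2 ℕ.* P))) (trans (List.length-reverse σ) lσ) ⟩
      gammaTerm n (+ (2 ℕ.^ (2 ℕ.* P))) P x + peaklessSign P e * (1ℤ - x) ^ n
        ≡⟨ cong₂ _+_ (sym (gammaSum-δ h P (λ q → + (2 ℕ.^ (2 ℕ.* q))) P≤h))
                     (trans (cong (peaklessSign P e *_) (oneMinus-gammaSum h)) (gammaSum-*ˡ h (peaklessSign P e) (oneMinusCoeff h))) ⟩
      gammaSum h (λ q → guard (does (P ℕ.≟ q)) (+ (2 ℕ.^ (2 ℕ.* q)))) + gammaSum h (λ q → peaklessSign P e * oneMinusCoeff h q)
        ≡⟨ gammaSum-+ h (λ q → guard (does (P ℕ.≟ q)) (+ (2 ℕ.^ (2 ℕ.* q)))) (λ q → peaklessSign P e * oneMinusCoeff h q) ⟩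
      gammaSum h (λ q → guard (does (P ℕ.≟ q)) (+ (2 ℕ.^ (2 ℕ.* q))) + peaklessSign P e * oneMinusCoeff h q)
        ≡⟨ ∑-cong (upTo (suc h)) (λ q → cong (λ c → gammaTerm n c q x) (sym (evenCoefficient-*2 h P e q))) ⟩
      gammaSum h (λ q → coefficient σ q * + 2)
        ≡⟨ ∑-cong (upTo (suc h)) (λ q → cong (λ c → gammaTerm n c q x) (ℤP.*-comm (coefficient σ q) (+ 2))) ⟩
      gammaSum h (λ q → + 2 * coefficient σ q)
        ≡⟨ trans (sym (gammaSum-*ˡ h (+ 2) (coefficient σ))) (ℤP.*-comm (+ 2) _) ⟩
      gammaSum h (coefficient σ) * + 2 ∎)
      where
      open ≡-Reasoning
      open GammaBasis x
      open Transfer 0 using (module Weights; totalExponent)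
      r = reverse σ
      P = Transfer.peaks 0 r
      e = totalExponent r [x+ω]
      P≤h : P ℕ.< suc h
      P≤h = s≤s (subst (P ℕ.≤_) (trans (cong (_/ 2) (ℕP.*-comm 2 h)) (ℕ.m*n/n≡m h 2))
                  (≤-half P n (subst (2 ℕ.* P ℕ.≤_) (trans (List.length-reverse σ) lσ) (Transfer.peaks-bound 0 r z≤n))))

    γ : ℕ → ℤ
    γ q = ∑ (words (positives n) n) (λ u → guard (does (unique? u)) (coefficient u q))

    WD-gammaExpansion : (x : ℤ) → WD n 1 x ≡ gammaExpansion n 1 γ x
    WD-gammaExpansion x = begin
      WD n 1 x
        ≡⟨ WD-∑-unsigned n 1 x ⟩
      ∑ W (λ u → guard (does (unique? u)) (evenSignSum n 1 x u))
        ≡⟨ ∑-permutations-cong n (λ u lu pu du → evenSignSum-gammaSum x u du pu lu) ⟩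
      ∑ W (λ u → guard (does (unique? u)) (gammaSum h (coefficient u)))
        ≡⟨ ∑-cong W (λ u → guard-gammaSum (does (unique? u)) (coefficient u)) ⟩
      ∑ W (λ u → gammaSum h (λ q → guard (does (unique? u)) (coefficient u q)))
        ≡⟨ ∑-gammaSum W (λ u q → guard (does (unique? u)) (coefficient u q)) h ⟩
      gammaSum h γ
        ≡⟨ cong (λ t → ∑ (upTo (suc t)) (λ q → gammaTerm n (γ q) q x)) (sym (trans (cong (_/ 2) (ℕP.*-comm 2 h)) (ℕ.m*n/n≡m h 2))) ⟩
      gammaExpansion n 1 γ x ∎
      where
      open ≡-Reasoning
      open GammaBasis x
      W = words (positives n) n
      guard-gammaSum : (b : Bool) (f : ℕ → ℤ) → guard b (gammaSum h f) ≡ gammaSum h (λ q → guard b (f q))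
      guard-gammaSum true f = refl
      guard-gammaSum false f = sym (∑-zero (upTo (suc h)))

  γ-*2 : (j n p : ℕ) → Step≥2.γ j n p * + 2 ≡ + (2 ℕ.^ (2 ℕ.* p ℕ.+ suc (suc j) ∸ 1) ℕ.* GammaCard n (suc (suc j)) p)
  γ-*2 j n p = trans (sym (ℤP.pos-* (2 ℕ.^ (2 ℕ.* p ℕ.+ j) ℕ.* G) 2)) (cong +_ (begin
    2 ℕ.^ (2 ℕ.* p ℕ.+ j) ℕ.* G ℕ.* 2        ≡⟨ double (2 ℕ.^ (2 ℕ.* p ℕ.+ j)) G ⟩
    2 ℕ.^ suc (2 ℕ.* p ℕ.+ j) ℕ.* G          ≡⟨ cong (λ e → 2 ℕ.^ e ℕ.* G) (sym (trans (cong (_∸ 1) (ℕP.+-suc (2 ℕ.* p) (suc j))) (ℕP.+-suc (2 ℕ.* p) j))) ⟩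
    2 ℕ.^ (2 ℕ.* p ℕ.+ suc (suc j) ∸ 1) ℕ.* G ∎))
    where
    open ≡-Reasoning
    G = GammaCard n (suc (suc j)) p
    double : ∀ a g → a ℕ.* g ℕ.* 2 ≡ 2 ℕ.* a ℕ.* g
    double = ℕ-Solver.solve-∀

  even-half : (n : ℕ) → ¬ (n % 2 ≡ 1) → n ≡ 2 ℕ.* (n / 2)
  even-half n n-odd̸ = trans (ℕ.m≡m%n+[m/n]*n n 2) (trans (cong (ℕ._+ (n / 2) ℕ.* 2) (even n n-odd̸)) (ℕP.*-comm (n / 2) 2))
    where
    even : (n : ℕ) → ¬ (n % 2 ≡ 1) → n % 2 ≡ 0
    even n ¬odd with n % 2 | ℕ.m%n<n n 2
    ... | 0 | _ = refl
    ... | 1 | _ = ⊥-elim (¬odd refl)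
    ... | suc (suc _) | s≤s (s≤s ())

  WD-gammaExpansion-even : (n : ℕ) → ¬ (n % 2 ≡ 1) → ∃[ γ ] ((x : ℤ) → WD n 1 x ≡ gammaExpansion n 1 γ x)
  WD-gammaExpansion-even n not-odd = subst (λ m → ∃[ γ ] ((x : ℤ) → WD m 1 x ≡ gammaExpansion m 1 γ x))
    (sym (even-half n not-odd)) (Step1.γ (n / 2) , Step1.WD-gammaExpansion (n / 2))

open import Data.Nat using (ℕ; _≤_; _+_; _*_; _^_; _/_; _∸_; _%_)
open import Data.Integer using (ℤ; +_)
open import Data.Product using (_×_; ∃-syntax)
open import Relation.Nullary using (¬_)
open import Relation.Binary.PropositionalEquality using (_≡_)

open import Data.Nat using (zero; suc; s≤s)
open import Data.Product using (_,_; proj₁; proj₂)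
open import Relation.Binary.PropositionalEquality using (refl)
open SignedDescents

theorem29 : (n k : ℕ) → 1 ≤ k → k ≤ n → ¬ ((n % 2 ≡ 1) × (k ≡ 1)) →
    ∃[ γ ] (((x : ℤ) → WD n k x ≡ gammaExpansion n k γ x) ×
      (2 ≤ k → (p : ℕ) → p ≤ (n + 1 ∸ k) / 2 →
        γ p Data.Integer.* (+ 2) ≡ + (2 ^ (2 * p + k ∸ 1) * GammaCard n k p)))
theorem29 n zero () _ _
theorem29 n (suc zero) _ _ not-odd = proj₁ even , proj₂ even , λ { (s≤s ()) }
  where
  even = WD-gammaExpansion-even n (λ odd → not-odd (odd , refl))
theorem29 n (suc (suc j)) _ k≤n _ =
  Step≥2.γ j n , Step≥2.WD-gammaExpansion j n k≤n , λ _ p _ → γ-*2 j n p
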